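{- For integers $\ell,m\geq 0$, let $c_{\ell,m}$ be the number of maximally expanded $\alpha$-trees for $\alpha=(\mathrm{out},\underbrace{\mathrm{in},\dots,\mathrm{in}}_{\ell},\mathrm{out},\underbrace{\mathrm{in},\dots,\mathrm{in}}_{m})$. Then \[ c_{\ell,m}=c_{\ell+2}\, c_{m+2}\cdot \frac{(\ell+1)(\ell+2)(m+1)(m+2)}{2(\ell+m+1)(\ell+m+2)}=\binom{2(\ell+1)}{\ell+1}\binom{2(m+1)}{m+1}\cdot\frac{(\ell+1)(m+1)}{2(\ell+m+1)(\ell+m+2)}, \] where $c_p=\frac1p\binom{2(p-1)}{p-1}$ is the Catalan number $C_{p-1}$.
   Context: An $\alpha$-tree, for $\alpha$ a finite sequence of labels in $\{\mathrm{in},\mathrm{out}\}$, is a planar (plane-embedded) tree with directed edges and at least one interior (non-leaf) vertex, together with a chosen exterior vertex (leaf), such that: labelling each exterior vertex "in" if its incident edge is directed away from it and "out" if directed toward it, and reading exterior vertices in clockwise order from the chosen one, gives exactly $\alpha$; every interior vertex has at least one outgoing edge; and there is no bivalent vertex with one incoming and one outgoing edge. An edge is interior if both endpoints are interior vertices. $T'$ is an edge expansion of $T$ if contracting some nonempty set of interior edges of $T'$ yields $T$; $T$ is maximally expanded if it has no edge expansion. For $\alpha=(\mathrm{out},\mathrm{out})$ there is exactly one $\alpha$-tree, so $c_{0,0}=1$. -}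

module Defs where

open import Data.Nat using (ℕ; zero; suc; _+_; _*_; _/_)
open import Data.Nat.Combinatorics using (_C_)
open import Data.List using (List; []; _∷_; _++_; [_]; replicate; length)
open import Data.List.Relation.Unary.Any using (Any)
open import Data.List.Relation.Unary.Unique.Propositional using (Unique)
open import Data.List.Membership.Propositional using (_∈_)
open import Data.Product using (Σ; ∃; _×_; _,_; proj₁)
open import Data.Sum using (_⊎_)
open import Data.Unit using (⊤)
open import Relation.Nullary using (¬_)
open import Relation.Binary.PropositionalEquality using (_≡_; _≢_)
open import Relation.Binary.Construct.Closure.Transitive using (TransClosure)
open import Function.Bundles using (_⇔_)

-- Orientation of an edge relative to the chosen (root) leaf:
-- 'up' = directed towards the root side (child → parent),
-- 'down' = directed away from the root side (parent → child).
data Dir : Set where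
  up down : Dir

data Label : Set where
  In Out : Label

-- Planar trees hanging below an edge.  'leaf' is an exterior vertex;
-- 'node cs' is an interior vertex whose further edges (other than the
-- edge towards the root) are listed in clockwise order, each with its
-- direction and the subtree at its other end.
data Tree : Set where
  leaf : Tree
  node : List (Dir × Tree) → Tree

-- An α-tree candidate: the chosen exterior vertex (root leaf), the
-- direction of its unique edge, and the tree at the other end of it.
-- Plane trees with a chosen leaf up to isomorphism correspond exactly to
-- such data.
ATree : Set
ATree = Dir × Tree

childLabel : Dir → Label
childLabel up   = In    -- edge directed away from the leaf
childLabel down = Out   -- edge directed toward the leaf

rootLabel : Dir → Label
rootLabel up   = Out    -- edge directed toward the root leaf
rootLabel down = In

leafLabels : List (Dir × Tree) → List Label
leafLabels [] = []
leafLabels ((d , leaf) ∷ cs) = childLabel d ∷ leafLabels cs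
leafLabels ((d , node ds) ∷ cs) = leafLabels ds ++ leafLabels cs

labels : ATree → List Label
labels (d , leaf) = rootLabel d ∷ childLabel d ∷ []
labels (d , node cs) = rootLabel d ∷ leafLabels cs

-- Local conditions at an interior vertex with parent edge direction p and
-- further edges cs.  The parent edge is outgoing iff p ≡ up; an edge to a
-- child is outgoing iff its direction is down.
HasOutgoing : Dir → List (Dir × Tree) → Set
HasOutgoing p cs = p ≡ up ⊎ Any (λ e → proj₁ e ≡ down) cs

NotBivalentInOut : Dir → List (Dir × Tree) → Set
NotBivalentInOut p cs = ∀ d t → cs ≡ (d , t) ∷ [] → p ≢ d

NonEmpty : List (Dir × Tree) → Set
NonEmpty cs = cs ≢ []

mutual
  ValidBelow : Dir → Tree → Set
  ValidBelow p leaf = ⊤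
  ValidBelow p (node cs) =
    NonEmpty cs × HasOutgoing p cs × NotBivalentInOut p cs × AllValid cs

  AllValid : List (Dir × Tree) → Set
  AllValid [] = ⊤
  AllValid ((d , t) ∷ cs) = ValidBelow d t × AllValid cs

IsInterior : Tree → Set
IsInterior t = ∃ λ cs → t ≡ node cs

IsAlphaTree : List Label → ATree → Set
IsAlphaTree α (d , t) = IsInterior t × ValidBelow d t × labels (d , t) ≡ α

mutual
  data Contract : Tree → Tree → Set where
    here  : ∀ xs d ws ys →
            Contract (node (xs ++ (d , node ws) ∷ ys)) (node (xs ++ ws ++ ys))
    under : ∀ xs d {t t'} ys → Contract t t' →
            Contract (node (xs ++ (d , t) ∷ ys)) (node (xs ++ (d , t') ∷ ys))

ContractA : ATree → ATree → Set
ContractA (d , t) (d' , t') = d ≡ d' × Contract t t'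

IsEdgeExpansion : ATree → ATree → Set
IsEdgeExpansion T' T = TransClosure ContractA T' T

MaximallyExpanded : List Label → ATree → Set
MaximallyExpanded α T =
  IsAlphaTree α T × ¬ (∃ λ T' → IsAlphaTree α T' × IsEdgeExpansion T' T)

alpha : ℕ → ℕ → List Label
alpha ℓ m = Out ∷ replicate ℓ In ++ Out ∷ replicate m In

catalan : ℕ → ℕ
catalan n = ((2 * n) C n) / suc n

-- c_p = C_{p-1}; so c_{ℓ+2} = catalan (ℓ + 1)

HasCount : (ATree → Set) → ℕ → Set
HasCount P N = Σ (List ATree) λ ts →
  Unique ts × (∀ T → (T ∈ ts) ⇔ P T) × length ts ≡ N

module Submission where

-- A maximally expanded α-tree is the same as a tight tree: every interior vertex is a bivalent
-- source or is trivalent with exactly one outgoing edge. Indeed, summing (valence − 1 + out-degree)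
-- over the interior vertices gives at least 3 per vertex, with equality exactly at tight vertices,
-- and every edge contraction lowers the sum by 2 while removing one vertex; so a tight tree has no
-- expansion, while any other tree can be split at some vertex.
-- For α = (out, in^ℓ, out, in^m) the root edge points to the root and the other labels contain a single
-- out, so the tree has exactly one source. Along the path from the root to the source hang all-in binary
-- trees, counted by Catalan numbers, and this path has the same recursive structure as a tight tree below
-- an out-leaf, of which there are C_{a+b} with a in-leaves on one side and b on the other. Hence
-- c_{ℓ,m} = Σ_{a₁+a₂=ℓ} Σ_{b₁+b₂=m} C_{a₁+b₁} C_{a₂+b₂}, and the closed form follows from the identity
-- 2(n+1)(n+2) Σ_{x+y=a} C_{x+b₁} C_{y+b₂} = X(a+b₁, b₂) + X(a+b₂, b₁), n = a+b₁+b₂,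
-- X(u, v) = (u+1−v) binom(2u+2, u+1) binom(2v, v), proved by induction on a.

open import Algebra.Bundles using (CommutativeSemiring)
import Data.Nat.Properties

module SplitSum {c ℓ} (R : CommutativeSemiring c ℓ) where

  open import Data.Nat using (ℕ; zero; suc) renaming (_+_ to _+ℕ_)
  open import Relation.Binary.PropositionalEquality as ≡ using (_≡_)
  open CommutativeSemiring R
  open import Relation.Binary.Reasoning.Setoid setoid
  open import Algebra.Properties.CommutativeSemigroup +-commutativeSemigroup using (interchange)

  Σ-split : ℕ → (ℕ → ℕ → Carrier) → Carrier
  Σ-split zero    g = g 0 0
  Σ-split (suc n) g = g 0 (suc n) + Σ-split n (λ i j → g (suc i) j)

  Σ-split-cong : ∀ n {g h : ℕ → ℕ → Carrier} → (∀ i j → i +ℕ j ≡ n → g i j ≈ h i j) →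
                 Σ-split n g ≈ Σ-split n h
  Σ-split-cong zero    g≈h = g≈h 0 0 ≡.refl
  Σ-split-cong (suc n) g≈h = +-cong (g≈h 0 (suc n) ≡.refl) (Σ-split-cong n (λ i j e → g≈h (suc i) j (≡.cong suc e)))

  Σ-split-last : ∀ n g → Σ-split (suc n) g ≈ Σ-split n (λ i j → g i (suc j)) + g (suc n) 0
  Σ-split-last zero    g = refl
  Σ-split-last (suc n) g = begin
    g 0 (suc (suc n)) + Σ-split (suc n) (λ i j → g (suc i) j)
      ≈⟨ +-congˡ (Σ-split-last n (λ i j → g (suc i) j)) ⟩
    g 0 (suc (suc n)) + (Σ-split n (λ i j → g (suc i) (suc j)) + g (suc (suc n)) 0)
      ≈⟨ +-assoc _ _ _ ⟨
    g 0 (suc (suc n)) + Σ-split n (λ i j → g (suc i) (suc j)) + g (suc (suc n)) 0 ∎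

  Σ-split-swap : ∀ n g → Σ-split n g ≈ Σ-split n (λ i j → g j i)
  Σ-split-swap zero    g = refl
  Σ-split-swap (suc n) g = begin
    Σ-split (suc n) g                            ≈⟨ Σ-split-last n g ⟩
    Σ-split n (λ i j → g i (suc j)) + g (suc n) 0 ≈⟨ +-congʳ (Σ-split-swap n (λ i j → g i (suc j))) ⟩
    Σ-split n (λ i j → g j (suc i)) + g (suc n) 0 ≈⟨ +-comm _ _ ⟩
    Σ-split (suc n) (λ i j → g j i)              ∎

  Σ-split-+ : ∀ n g h → Σ-split n (λ i j → g i j + h i j) ≈ Σ-split n g + Σ-split n h
  Σ-split-+ zero    g h = refl
  Σ-split-+ (suc n) g h = begin
    g 0 (suc n) + h 0 (suc n) + Σ-split n (λ i j → g (suc i) j + h (suc i) j)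
      ≈⟨ +-congˡ (Σ-split-+ n (λ i j → g (suc i) j) (λ i j → h (suc i) j)) ⟩
    g 0 (suc n) + h 0 (suc n) + (Σ-split n (λ i j → g (suc i) j) + Σ-split n (λ i j → h (suc i) j))
      ≈⟨ interchange _ _ _ _ ⟩
    Σ-split (suc n) g + Σ-split (suc n) h ∎

  Σ-split-*ˡ : ∀ n k g → Σ-split n (λ i j → k * g i j) ≈ k * Σ-split n g
  Σ-split-*ˡ zero    k g = refl
  Σ-split-*ˡ (suc n) k g = begin
    k * g 0 (suc n) + Σ-split n (λ i j → k * g (suc i) j) ≈⟨ +-congˡ (Σ-split-*ˡ n k (λ i j → g (suc i) j)) ⟩
    k * g 0 (suc n) + k * Σ-split n (λ i j → g (suc i) j) ≈⟨ distribˡ k _ _ ⟨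
    k * Σ-split (suc n) g                                ∎

  Σ-split-*ʳ : ∀ n k g → Σ-split n (λ i j → g i j * k) ≈ Σ-split n g * k
  Σ-split-*ʳ n k g = begin
    Σ-split n (λ i j → g i j * k) ≈⟨ Σ-split-cong n (λ i j _ → *-comm (g i j) k) ⟩
    Σ-split n (λ i j → k * g i j) ≈⟨ Σ-split-*ˡ n k g ⟩
    k * Σ-split n g               ≈⟨ *-comm k _ ⟩
    Σ-split n g * k               ∎

module ℕΣ = SplitSum Data.Nat.Properties.+-*-commutativeSemiring

module CentralBinomial where

  open import Data.Nat
  open import Data.Nat.Properties
  open import Data.Nat.DivMod using (m*n/n≡m)
  open import Data.Nat.Combinatorics using (_C_; nC1≡n; nCk≡nC[n∸k]; nCk+nC[k+1]≡[n+1]C[k+1])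
  open import Data.Nat.Tactic.RingSolver using (solve-∀)
  open import Relation.Binary.PropositionalEquality
  open ≡-Reasoning
  open import Defs using (catalan)

  central : ℕ → ℕ
  central n = (2 * n) C n

  [1+k]*[1+n]C[1+k]≡[1+n]*nCk : ∀ n k → suc k * (suc n C suc k) ≡ suc n * (n C k)
  [1+k]*[1+n]C[1+k]≡[1+n]*nCk zero    zero    = refl
  [1+k]*[1+n]C[1+k]≡[1+n]*nCk zero    (suc k) = *-zeroʳ (suc (suc k))
  [1+k]*[1+n]C[1+k]≡[1+n]*nCk (suc n) zero    = begin
    1 * (suc (suc n) C 1) ≡⟨ *-identityˡ _ ⟩
    suc (suc n) C 1       ≡⟨ nC1≡n (suc (suc n)) ⟩
    suc (suc n)           ≡⟨ *-identityʳ (suc (suc n)) ⟨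
    suc (suc n) * 1       ∎
  [1+k]*[1+n]C[1+k]≡[1+n]*nCk (suc n) (suc k) = begin
    suc (suc k) * (suc (suc n) C suc (suc k))
      ≡⟨ cong (suc (suc k) *_) (nCk+nC[k+1]≡[n+1]C[k+1] (suc n) (suc k)) ⟨
    suc (suc k) * (X + Y)
      ≡⟨ split k X Y ⟩
    suc k * X + X + suc (suc k) * Y
      ≡⟨ cong₂ (λ a b → a + X + b) ([1+k]*[1+n]C[1+k]≡[1+n]*nCk n k) ([1+k]*[1+n]C[1+k]≡[1+n]*nCk n (suc k)) ⟩
    suc n * (n C k) + X + suc n * (n C suc k)
      ≡⟨ regroup n (n C k) (n C suc k) X ⟩
    suc n * (n C k + n C suc k) + X
      ≡⟨ cong (λ z → suc n * z + X) (nCk+nC[k+1]≡[n+1]C[k+1] n k) ⟩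
    suc n * X + X
      ≡⟨ +-comm (suc n * X) X ⟩
    suc (suc n) * X ∎
    where
    X = suc n C suc k
    Y = suc n C suc (suc k)
    split : ∀ k X Y → suc (suc k) * (X + Y) ≡ suc k * X + X + suc (suc k) * Y
    split = solve-∀
    regroup : ∀ n U V X → suc n * U + X + suc n * V ≡ suc n * (U + V) + X
    regroup = solve-∀

  [1+n]*2nC[1+n]≡n*central : ∀ n → suc n * (2 * n C suc n) ≡ n * central n
  [1+n]*2nC[1+n]≡n*central n = +-cancelʳ-≡ (suc n * central n) _ _ (begin
    suc n * (2 * n C suc n) + suc n * central n
      ≡⟨ *-distribˡ-+ (suc n) (2 * n C suc n) (central n) ⟨
    suc n * (2 * n C suc n + central n)
      ≡⟨ cong (suc n *_) (trans (+-comm _ (central n)) (nCk+nC[k+1]≡[n+1]C[k+1] (2 * n) n)) ⟩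
    suc n * (suc (2 * n) C suc n)
      ≡⟨ [1+k]*[1+n]C[1+k]≡[1+n]*nCk (2 * n) n ⟩
    suc (2 * n) * central n
      ≡⟨ split n (central n) ⟩
    n * central n + suc n * central n ∎)
    where
    split : ∀ n x → suc (2 * n) * x ≡ n * x + suc n * x
    split = solve-∀

  -- catalan n is defined by a division; its exact quotient is central n ∸ 2n C (n+1).
  catalan*[1+n]≡central : ∀ n → catalan n * suc n ≡ central n
  catalan*[1+n]≡central n = trans (cong (_* suc n) catalan≡q) q*[1+n]≡central
    where
    q : ℕ
    q = central n ∸ 2 * n C suc n
    q*[1+n]≡central : q * suc n ≡ central n
    q*[1+n]≡central = begin
      q * suc n
        ≡⟨ *-distribʳ-∸ (suc n) (central n) (2 * n C suc n) ⟩
      central n * suc n ∸ (2 * n C suc n) * suc n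
        ≡⟨ cong₂ _∸_ (*-comm (central n) (suc n)) (trans (*-comm _ (suc n)) ([1+n]*2nC[1+n]≡n*central n)) ⟩
      central n + n * central n ∸ n * central n
        ≡⟨ m+n∸n≡m (central n) (n * central n) ⟩
      central n ∎
    catalan≡q : catalan n ≡ q
    catalan≡q = trans (cong (_/ suc n) (sym q*[1+n]≡central)) (m*n/n≡m q (suc n))

  central[1+n]*[1+n]≡2[2n+1]*central : ∀ n → central (suc n) * suc n ≡ 2 * suc (2 * n) * central n
  central[1+n]*[1+n]≡2[2n+1]*central n = begin
    central (suc n) * suc n
      ≡⟨ *-comm (central (suc n)) (suc n) ⟩
    suc n * (2 * suc n C suc n)
      ≡⟨ cong (λ m → suc n * (m C suc n)) (*-suc 2 n) ⟩
    suc n * (suc (suc (2 * n)) C suc n)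
      ≡⟨ [1+k]*[1+n]C[1+k]≡[1+n]*nCk (suc (2 * n)) n ⟩
    suc (suc (2 * n)) * (suc (2 * n) C n)
      ≡⟨ cong (_* (suc (2 * n) C n)) (*-suc 2 n) ⟨
    2 * suc n * (suc (2 * n) C n)
      ≡⟨ *-assoc 2 (suc n) _ ⟩
    2 * (suc n * (suc (2 * n) C n))
      ≡⟨ cong (λ x → 2 * (suc n * x)) symmetric ⟩
    2 * (suc n * (suc (2 * n) C suc n))
      ≡⟨ cong (2 *_) ([1+k]*[1+n]C[1+k]≡[1+n]*nCk (2 * n) n) ⟩
    2 * (suc (2 * n) * central n)
      ≡⟨ *-assoc 2 (suc (2 * n)) (central n) ⟨
    2 * suc (2 * n) * central n ∎
    where
    symmetric : suc (2 * n) C n ≡ suc (2 * n) C suc n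
    symmetric = trans (nCk≡nC[n∸k] (≤-trans (m≤m+n n (n + 0)) (n≤1+n _)))
                      (cong (suc (2 * n) C_) (trans (cong (_∸ n) (regroup n)) (m+n∸n≡m (suc n) n)))
      where
      regroup : ∀ n → suc (2 * n) ≡ suc n + n
      regroup = solve-∀

module CatalanConvolution where

  open import Defs using (catalan)
  open CentralBinomial
  open import Data.Nat as ℕ using (ℕ; zero; suc)
  import Data.Nat.Properties as ℕ
  open import Data.Integer using (ℤ; +_; _+_; _*_; _-_; 0ℤ; 1ℤ)
  open import Data.Integer.Properties
    using (pos-+; pos-*; +-injective; *-cancelˡ-≡; +-*-commutativeSemiring; *-distribˡ-+; +-identityˡ; *-comm)
  open import Data.Integer.Tactic.RingSolver using (solve-∀)
  import Data.Nat.Tactic.RingSolver as ℕSolver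
  open import Relation.Binary.PropositionalEquality
  open ≡-Reasoning

  module ℤΣ = SplitSum +-*-commutativeSemiring

  Σ-split-pos : ∀ n g → + ℕΣ.Σ-split n g ≡ ℤΣ.Σ-split n (λ i j → + g i j)
  Σ-split-pos zero    g = refl
  Σ-split-pos (suc n) g =
    trans (pos-+ (g 0 (suc n)) _) (cong (λ z → + g 0 (suc n) + z) (Σ-split-pos n (λ i j → g (suc i) j)))

  pos-suc : ∀ n → + suc n ≡ + n + 1ℤ
  pos-suc n = trans (cong +_ (ℕ.+-comm 1 n)) (pos-+ n 1)

  *-cancel-[1+n]ˡ : ∀ n {x y} → (+ n + 1ℤ) * x ≡ (+ n + 1ℤ) * y → x ≡ y
  *-cancel-[1+n]ˡ n {x} {y} eq = *-cancelˡ-≡ (+ suc n) x y (subst (λ k → k * x ≡ k * y) (sym (pos-suc n)) eq)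

  catalanℤ : ∀ n → + catalan n * (+ n + 1ℤ) ≡ + central n
  catalanℤ n = begin
    + catalan n * (+ n + 1ℤ)   ≡⟨ cong (λ z → + catalan n * z) (pos-suc n) ⟨
    + catalan n * + suc n      ≡⟨ pos-* (catalan n) (suc n) ⟨
    + (catalan n ℕ.* suc n)    ≡⟨ cong +_ (catalan*[1+n]≡central n) ⟩
    + central n                ∎

  central-stepℤ : ∀ n → + central (suc n) * (+ n + 1ℤ) ≡ + 2 * (+ 2 * + n + 1ℤ) * + central n
  central-stepℤ n = begin
    + central (suc n) * (+ n + 1ℤ)            ≡⟨ cong (λ z → + central (suc n) * z) (pos-suc n) ⟨
    + central (suc n) * + suc n               ≡⟨ pos-* (central (suc n)) (suc n) ⟨
    + (central (suc n) ℕ.* suc n)             ≡⟨ cong +_ (central[1+n]*[1+n]≡2[2n+1]*central n) ⟩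
    + (2 ℕ.* suc (2 ℕ.* n) ℕ.* central n)     ≡⟨ pos-* (2 ℕ.* suc (2 ℕ.* n)) (central n) ⟩
    + (2 ℕ.* suc (2 ℕ.* n)) * + central n     ≡⟨ cong (_* + central n) coefficient ⟩
    + 2 * (+ 2 * + n + 1ℤ) * + central n      ∎
    where
    coefficient : + (2 ℕ.* suc (2 ℕ.* n)) ≡ + 2 * (+ 2 * + n + 1ℤ)
    coefficient = trans (pos-* 2 (suc (2 ℕ.* n)))
                        (cong (λ z → + 2 * z) (trans (pos-suc (2 ℕ.* n)) (cong (_+ 1ℤ) (pos-* 2 n))))

  -- 2(n+1)(n+2), computed in ℕ so that the NonZero instance used to cancel it is found automatically
  weight : ℕ → ℤ
  weight n = + (2 ℕ.* suc n ℕ.* suc (suc n))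

  weight-poly : ∀ n → weight n ≡ + 2 * (+ n + 1ℤ) * (+ n + 1ℤ + 1ℤ)
  weight-poly n = begin
    + (2 ℕ.* suc n ℕ.* suc (suc n))  ≡⟨ pos-* (2 ℕ.* suc n) (suc (suc n)) ⟩
    + (2 ℕ.* suc n) * + suc (suc n)  ≡⟨ cong₂ _*_ (pos-* 2 (suc n)) (pos-suc (suc n)) ⟩
    + 2 * + suc n * (+ suc n + 1ℤ)   ≡⟨ cong (λ k → + 2 * k * (k + 1ℤ)) (pos-suc n) ⟩
    + 2 * (+ n + 1ℤ) * (+ n + 1ℤ + 1ℤ) ∎

  weight-+ : ∀ u v → weight (u ℕ.+ v) ≡ + 2 * (+ u + + v + 1ℤ) * (+ u + + v + 1ℤ + 1ℤ)
  weight-+ u v = trans (weight-poly (u ℕ.+ v)) (cong (λ k → + 2 * (k + 1ℤ) * (k + 1ℤ + 1ℤ)) (pos-+ u v))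

  cross : ℕ → ℕ → ℤ
  cross u v = (+ u + 1ℤ - + v) * + central (suc u) * + central v

  cross-cancel : ∀ u v → cross u (suc v) + cross v (suc u) ≡ 0ℤ
  cross-cancel u v = begin
    cross u (suc v) + cross v (suc u)
      ≡⟨ cong₂ (λ p q → (+ u + 1ℤ - p) * X * Y + (+ v + 1ℤ - q) * Y * X) (pos-suc v) (pos-suc u) ⟩
    (+ u + 1ℤ - (+ v + 1ℤ)) * X * Y + (+ v + 1ℤ - (+ u + 1ℤ)) * Y * X
      ≡⟨ antisymmetric (+ u) (+ v) X Y ⟩
    0ℤ ∎
    where
    X = + central (suc u)
    Y = + central (suc v)
    antisymmetric : ∀ u v x y → (u + 1ℤ - (v + 1ℤ)) * x * y + (v + 1ℤ - (u + 1ℤ)) * y * x ≡ 0ℤ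
    antisymmetric = solve-∀

  weight*catalan*catalan : ∀ u v → weight (u ℕ.+ v) * + (catalan u ℕ.* catalan v) ≡ cross u v + cross v u
  weight*catalan*catalan u v = *-cancel-[1+n]ˡ u (*-cancel-[1+n]ˡ v (begin
    V * (U * (weight (u ℕ.+ v) * + (catalan u ℕ.* catalan v)))
      ≡⟨ cong₂ (λ w p → V * (U * (w * p))) (weight-+ u v) (pos-* (catalan u) (catalan v)) ⟩
    V * (U * (+ 2 * (+ u + + v + 1ℤ) * (+ u + + v + 1ℤ + 1ℤ) * (+ catalan u * + catalan v)))
      ≡⟨ regroup₁ (+ u) (+ v) (+ catalan u) (+ catalan v) ⟩
    + 2 * (+ u + + v + 1ℤ) * (+ u + + v + 1ℤ + 1ℤ) * (+ catalan u * U) * (+ catalan v * V)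
      ≡⟨ cong₂ (λ x y → + 2 * (+ u + + v + 1ℤ) * (+ u + + v + 1ℤ + 1ℤ) * x * y) (catalanℤ u) (catalanℤ v) ⟩
    + 2 * (+ u + + v + 1ℤ) * (+ u + + v + 1ℤ + 1ℤ) * x * y
      ≡⟨ expand (+ u) (+ v) x y ⟩
    (U - + v) * V * (+ 2 * (+ 2 * + u + 1ℤ) * x) * y + (V - + u) * U * x * (+ 2 * (+ 2 * + v + 1ℤ) * y)
      ≡⟨ cong₂ (λ p q → (U - + v) * V * p * y + (V - + u) * U * x * q) (central-stepℤ u) (central-stepℤ v) ⟨
    (U - + v) * V * (x′ * U) * y + (V - + u) * U * x * (y′ * V)
      ≡⟨ regroup₂ (+ u) (+ v) x y x′ y′ ⟩
    V * (U * (cross u v + cross v u)) ∎))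
    where
    U = + u + 1ℤ
    V = + v + 1ℤ
    x = + central u
    y = + central v
    x′ = + central (suc u)
    y′ = + central (suc v)
    regroup₁ : ∀ u v p q →
      (v + 1ℤ) * ((u + 1ℤ) * (+ 2 * (u + v + 1ℤ) * (u + v + 1ℤ + 1ℤ) * (p * q))) ≡
      + 2 * (u + v + 1ℤ) * (u + v + 1ℤ + 1ℤ) * (p * (u + 1ℤ)) * (q * (v + 1ℤ))
    regroup₁ = solve-∀
    expand : ∀ u v x y →
      + 2 * (u + v + 1ℤ) * (u + v + 1ℤ + 1ℤ) * x * y ≡
      (u + 1ℤ - v) * (v + 1ℤ) * (+ 2 * (+ 2 * u + 1ℤ) * x) * y + (v + 1ℤ - u) * (u + 1ℤ) * x * (+ 2 * (+ 2 * v + 1ℤ) * y)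
    expand = solve-∀
    regroup₂ : ∀ u v x y x′ y′ →
      (u + 1ℤ - v) * (v + 1ℤ) * (x′ * (u + 1ℤ)) * y + (v + 1ℤ - u) * (u + 1ℤ) * x * (y′ * (v + 1ℤ)) ≡
      (v + 1ℤ) * ((u + 1ℤ) * ((u + 1ℤ - v) * x′ * y + (v + 1ℤ - u) * y′ * x))
    regroup₂ = solve-∀

  convolution : ℕ → ℕ → ℕ → ℕ
  convolution a b₁ b₂ = ℕΣ.Σ-split a (λ x y → catalan (x ℕ.+ b₁) ℕ.* catalan (y ℕ.+ b₂))

  convolution-suc : ∀ a b₁ b₂ →
    convolution (suc a) b₁ b₂ ≡ catalan b₁ ℕ.* catalan (suc (a ℕ.+ b₂)) ℕ.+ convolution a (suc b₁) b₂
  convolution-suc a b₁ b₂ = cong (catalan b₁ ℕ.* catalan (suc (a ℕ.+ b₂)) ℕ.+_)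
    (ℕΣ.Σ-split-cong a (λ x y _ → cong (λ k → catalan k ℕ.* catalan (y ℕ.+ b₂)) (sym (ℕ.+-suc x b₁))))

  weight*convolution : ∀ a b₁ b₂ →
    weight (a ℕ.+ b₁ ℕ.+ b₂) * + convolution a b₁ b₂ ≡ cross (a ℕ.+ b₁) b₂ + cross (a ℕ.+ b₂) b₁
  weight*convolution zero    b₁ b₂ = weight*catalan*catalan b₁ b₂
  weight*convolution (suc a) b₁ b₂ = begin
    weight (suc a ℕ.+ b₁ ℕ.+ b₂) * + convolution (suc a) b₁ b₂
      ≡⟨ cong (λ c → weight (suc a ℕ.+ b₁ ℕ.+ b₂) * + c) (convolution-suc a b₁ b₂) ⟩
    weight (suc a ℕ.+ b₁ ℕ.+ b₂) * + (P ℕ.+ Q)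
      ≡⟨ cong (weight (suc a ℕ.+ b₁ ℕ.+ b₂) *_) (pos-+ P Q) ⟩
    weight (suc a ℕ.+ b₁ ℕ.+ b₂) * (+ P + + Q)
      ≡⟨ *-distribˡ-+ (weight (suc a ℕ.+ b₁ ℕ.+ b₂)) (+ P) (+ Q) ⟩
    weight (suc a ℕ.+ b₁ ℕ.+ b₂) * + P + weight (suc a ℕ.+ b₁ ℕ.+ b₂) * + Q
      ≡⟨ cong₂ (λ m n → weight m * + P + weight n * + Q) total₁ total₂ ⟩
    weight (b₁ ℕ.+ suc (a ℕ.+ b₂)) * + P + weight (a ℕ.+ suc b₁ ℕ.+ b₂) * + Q
      ≡⟨ cong₂ _+_ (weight*catalan*catalan b₁ (suc (a ℕ.+ b₂))) (weight*convolution a (suc b₁) b₂) ⟩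
    (cross b₁ (suc (a ℕ.+ b₂)) + cross (suc (a ℕ.+ b₂)) b₁) + (cross (a ℕ.+ suc b₁) b₂ + cross (a ℕ.+ b₂) (suc b₁))
      ≡⟨ cong (λ k → (cross b₁ (suc (a ℕ.+ b₂)) + cross (suc (a ℕ.+ b₂)) b₁) + (cross k b₂ + cross (a ℕ.+ b₂) (suc b₁)))
              (ℕ.+-suc a b₁) ⟩
    (cross b₁ (suc (a ℕ.+ b₂)) + cross (suc (a ℕ.+ b₂)) b₁) + (cross (suc (a ℕ.+ b₁)) b₂ + cross (a ℕ.+ b₂) (suc b₁))
      ≡⟨ regroup (cross b₁ (suc (a ℕ.+ b₂))) (cross (suc (a ℕ.+ b₂)) b₁) (cross (suc (a ℕ.+ b₁)) b₂) (cross (a ℕ.+ b₂) (suc b₁)) ⟩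
    (cross b₁ (suc (a ℕ.+ b₂)) + cross (a ℕ.+ b₂) (suc b₁)) + (cross (suc (a ℕ.+ b₁)) b₂ + cross (suc (a ℕ.+ b₂)) b₁)
      ≡⟨ cong (_+ (cross (suc (a ℕ.+ b₁)) b₂ + cross (suc (a ℕ.+ b₂)) b₁)) (cross-cancel b₁ (a ℕ.+ b₂)) ⟩
    0ℤ + (cross (suc (a ℕ.+ b₁)) b₂ + cross (suc (a ℕ.+ b₂)) b₁)
      ≡⟨ +-identityˡ _ ⟩
    cross (suc a ℕ.+ b₁) b₂ + cross (suc a ℕ.+ b₂) b₁ ∎
    where
    P = catalan b₁ ℕ.* catalan (suc (a ℕ.+ b₂))
    Q = convolution a (suc b₁) b₂
    total₁ : suc a ℕ.+ b₁ ℕ.+ b₂ ≡ b₁ ℕ.+ suc (a ℕ.+ b₂)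
    total₁ = rearrange a b₁ b₂
      where
      rearrange : ∀ a b₁ b₂ → suc a ℕ.+ b₁ ℕ.+ b₂ ≡ b₁ ℕ.+ suc (a ℕ.+ b₂)
      rearrange = ℕSolver.solve-∀
    total₂ : suc a ℕ.+ b₁ ℕ.+ b₂ ≡ a ℕ.+ suc b₁ ℕ.+ b₂
    total₂ = cong (ℕ._+ b₂) (sym (ℕ.+-suc a b₁))
    regroup : ∀ p q r s → (p + q) + (r + s) ≡ (p + s) + (r + q)
    regroup = solve-∀

  weight*catalan : ∀ n → weight n * + catalan (suc n) ≡ cross n 0 + cross n 0
  weight*catalan n = begin
    weight n * + catalan (suc n)
      ≡⟨ cong (_* + catalan (suc n)) (weight-poly n) ⟩
    + 2 * (+ n + 1ℤ) * (+ n + 1ℤ + 1ℤ) * + catalan (suc n)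
      ≡⟨ regroup (+ n) (+ catalan (suc n)) ⟩
    + 2 * (+ n + 1ℤ) * (+ catalan (suc n) * (+ n + 1ℤ + 1ℤ))
      ≡⟨ cong (λ k → + 2 * (+ n + 1ℤ) * (+ catalan (suc n) * (k + 1ℤ))) (pos-suc n) ⟨
    + 2 * (+ n + 1ℤ) * (+ catalan (suc n) * (+ suc n + 1ℤ))
      ≡⟨ cong (+ 2 * (+ n + 1ℤ) *_) (catalanℤ (suc n)) ⟩
    + 2 * (+ n + 1ℤ) * + central (suc n)
      ≡⟨ double (+ n) (+ central (suc n)) ⟩
    cross n 0 + cross n 0 ∎
    where
    regroup : ∀ n k → + 2 * (n + 1ℤ) * (n + 1ℤ + 1ℤ) * k ≡ + 2 * (n + 1ℤ) * (k * (n + 1ℤ + 1ℤ))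
    regroup = solve-∀
    double : ∀ n x → + 2 * (n + 1ℤ) * x ≡ (n + 1ℤ - + 0) * x * 1ℤ + (n + 1ℤ - + 0) * x * 1ℤ
    double = solve-∀

  convolution-diagonal : ∀ n → convolution n 0 0 ≡ catalan (suc n)
  convolution-diagonal n = +-injective (*-cancelˡ-≡ (weight n) _ _ (begin
    weight n * + convolution n 0 0
      ≡⟨ cong (λ k → weight k * + convolution n 0 0) (trans (ℕ.+-identityʳ (n ℕ.+ 0)) (ℕ.+-identityʳ n)) ⟨
    weight (n ℕ.+ 0 ℕ.+ 0) * + convolution n 0 0
      ≡⟨ weight*convolution n 0 0 ⟩
    cross (n ℕ.+ 0) 0 + cross (n ℕ.+ 0) 0
      ≡⟨ cong (λ k → cross k 0 + cross k 0) (ℕ.+-identityʳ n) ⟩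
    cross n 0 + cross n 0
      ≡⟨ weight*catalan n ⟨
    weight n * + catalan (suc n) ∎))

  convolution-corner : ∀ a b → convolution b (suc a) 0 ℕ.+ convolution a 0 (suc b) ≡ catalan (suc (suc (a ℕ.+ b)))
  convolution-corner a b = +-injective (*-cancelˡ-≡ W _ _ (begin
    W * + (P ℕ.+ Q)
      ≡⟨ trans (cong (W *_) (pos-+ P Q)) (*-distribˡ-+ W (+ P) (+ Q)) ⟩
    W * + P + W * + Q
      ≡⟨ cong₂ (λ m n → weight m * + P + weight n * + Q) total₁ total₂ ⟩
    weight (b ℕ.+ suc a ℕ.+ 0) * + P + weight (a ℕ.+ 0 ℕ.+ suc b) * + Q
      ≡⟨ cong₂ _+_ (weight*convolution b (suc a) 0) (weight*convolution a 0 (suc b)) ⟩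
    (cross (b ℕ.+ suc a) 0 + cross (b ℕ.+ 0) (suc a)) + (cross (a ℕ.+ 0) (suc b) + cross (a ℕ.+ suc b) 0)
      ≡⟨ cong₂ (λ k l → (cross k 0 + cross (b ℕ.+ 0) (suc a)) + (cross (a ℕ.+ 0) (suc b) + cross l 0)) corner₁ (ℕ.+-suc a b) ⟩
    (X + cross (b ℕ.+ 0) (suc a)) + (cross (a ℕ.+ 0) (suc b) + X)
      ≡⟨ cong₂ (λ k l → (X + cross k (suc a)) + (cross l (suc b) + X)) (ℕ.+-identityʳ b) (ℕ.+-identityʳ a) ⟩
    (X + cross b (suc a)) + (cross a (suc b) + X)
      ≡⟨ regroup X (cross b (suc a)) (cross a (suc b)) ⟩
    (cross a (suc b) + cross b (suc a)) + (X + X)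
      ≡⟨ cong (_+ (X + X)) (cross-cancel a b) ⟩
    0ℤ + (X + X)
      ≡⟨ trans (+-identityˡ (X + X)) (sym (weight*catalan (suc (a ℕ.+ b)))) ⟩
    W * + catalan (suc (suc (a ℕ.+ b))) ∎))
    where
    W = weight (suc (a ℕ.+ b))
    X = cross (suc (a ℕ.+ b)) 0
    P = convolution b (suc a) 0
    Q = convolution a 0 (suc b)
    corner₁ : b ℕ.+ suc a ≡ suc (a ℕ.+ b)
    corner₁ = trans (ℕ.+-suc b a) (cong suc (ℕ.+-comm b a))
    total₁ : suc (a ℕ.+ b) ≡ b ℕ.+ suc a ℕ.+ 0
    total₁ = sym (trans (ℕ.+-identityʳ (b ℕ.+ suc a)) corner₁)
    total₂ : suc (a ℕ.+ b) ≡ a ℕ.+ 0 ℕ.+ suc b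
    total₂ = sym (trans (cong (ℕ._+ suc b) (ℕ.+-identityʳ a)) (ℕ.+-suc a b))
    regroup : ∀ x p q → (x + p) + (q + x) ≡ (q + p) + (x + x)
    regroup = solve-∀

  Σ-cross : ℕ → ℕ → ℤ
  Σ-cross a b = ℤΣ.Σ-split b (λ i j → cross (a ℕ.+ i) j)

  cross-step : ∀ a b →
    cross a (suc b) + cross a (suc b) + (+ suc a + 1ℤ) * (+ b + 1ℤ) * + central (suc (suc a)) * + central (suc b)
    ≡ (+ a + 1ℤ) * (+ suc b + 1ℤ) * + central (suc a) * + central (suc (suc b))
  cross-step a b = begin
    cross a (suc b) + cross a (suc b) + (+ suc a + 1ℤ) * B * x′ * y
      ≡⟨ cong₂ (λ p q → (A - p) * x * y + (A - p) * x * y + (q + 1ℤ) * B * x′ * y) (pos-suc b) (pos-suc a) ⟩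
    (A - B) * x * y + (A - B) * x * y + (A + 1ℤ) * B * x′ * y
      ≡⟨ regroup₁ (+ a) (+ b) x y x′ ⟩
    (A - B) * x * y + (A - B) * x * y + B * y * (x′ * (+ a + 1ℤ + 1ℤ))
      ≡⟨ cong (λ p → (A - B) * x * y + (A - B) * x * y + B * y * p) (trans (cong (λ k → x′ * (k + 1ℤ)) (sym (pos-suc a))) (central-stepℤ (suc a))) ⟩
    (A - B) * x * y + (A - B) * x * y + B * y * (+ 2 * (+ 2 * + suc a + 1ℤ) * x)
      ≡⟨ cong (λ k → (A - B) * x * y + (A - B) * x * y + B * y * (+ 2 * (+ 2 * k + 1ℤ) * x)) (pos-suc a) ⟩
    (A - B) * x * y + (A - B) * x * y + B * y * (+ 2 * (+ 2 * A + 1ℤ) * x)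
      ≡⟨ regroup₂ (+ a) (+ b) x y ⟩
    A * x * (+ 2 * (+ 2 * B + 1ℤ) * y)
      ≡⟨ cong (λ k → A * x * (+ 2 * (+ 2 * k + 1ℤ) * y)) (pos-suc b) ⟨
    A * x * (+ 2 * (+ 2 * + suc b + 1ℤ) * y)
      ≡⟨ cong (λ p → A * x * p) (trans (cong (λ k → y′ * (k + 1ℤ)) (sym (pos-suc b))) (central-stepℤ (suc b))) ⟨
    A * x * (y′ * (B + 1ℤ))
      ≡⟨ regroup₃ A B x y′ ⟩
    A * (B + 1ℤ) * x * y′
      ≡⟨ cong (λ k → A * (k + 1ℤ) * x * y′) (pos-suc b) ⟨
    A * (+ suc b + 1ℤ) * x * y′ ∎
    where
    A = + a + 1ℤ
    B = + b + 1ℤ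
    x = + central (suc a)
    y = + central (suc b)
    x′ = + central (suc (suc a))
    y′ = + central (suc (suc b))
    regroup₁ : ∀ a b x y x′ →
      ((a + 1ℤ) - (b + 1ℤ)) * x * y + ((a + 1ℤ) - (b + 1ℤ)) * x * y + ((a + 1ℤ) + 1ℤ) * (b + 1ℤ) * x′ * y ≡
      ((a + 1ℤ) - (b + 1ℤ)) * x * y + ((a + 1ℤ) - (b + 1ℤ)) * x * y + (b + 1ℤ) * y * (x′ * (a + 1ℤ + 1ℤ))
    regroup₁ = solve-∀
    regroup₂ : ∀ a b x y →
      ((a + 1ℤ) - (b + 1ℤ)) * x * y + ((a + 1ℤ) - (b + 1ℤ)) * x * y + (b + 1ℤ) * y * (+ 2 * (+ 2 * (a + 1ℤ) + 1ℤ) * x) ≡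
      (a + 1ℤ) * x * (+ 2 * (+ 2 * (b + 1ℤ) + 1ℤ) * y)
    regroup₂ = solve-∀
    regroup₃ : ∀ a b x y′ → a * x * (y′ * (b + 1ℤ)) ≡ a * (b + 1ℤ) * x * y′
    regroup₃ = solve-∀

  twice-Σ-cross : ∀ b a → Σ-cross a b + Σ-cross a b ≡ (+ a + 1ℤ) * (+ b + 1ℤ) * + central (suc a) * + central (suc b)
  twice-Σ-cross zero    a = begin
    cross (a ℕ.+ 0) 0 + cross (a ℕ.+ 0) 0           ≡⟨ cong (λ k → cross k 0 + cross k 0) (ℕ.+-identityʳ a) ⟩
    cross a 0 + cross a 0                          ≡⟨ base (+ a) (+ central (suc a)) ⟩
    (+ a + 1ℤ) * (+ 0 + 1ℤ) * + central (suc a) * + 2 ∎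
    where
    base : ∀ a x → (a + 1ℤ - + 0) * x * 1ℤ + (a + 1ℤ - + 0) * x * 1ℤ ≡ (a + 1ℤ) * (+ 0 + 1ℤ) * x * + 2
    base = solve-∀
  twice-Σ-cross (suc b) a = begin
    (cross (a ℕ.+ 0) (suc b) + S′) + (cross (a ℕ.+ 0) (suc b) + S′)
      ≡⟨ cong₂ (λ k S → (cross k (suc b) + S) + (cross k (suc b) + S)) (ℕ.+-identityʳ a) shift ⟩
    (cross a (suc b) + Σ-cross (suc a) b) + (cross a (suc b) + Σ-cross (suc a) b)
      ≡⟨ regroup (cross a (suc b)) (Σ-cross (suc a) b) ⟩
    cross a (suc b) + cross a (suc b) + (Σ-cross (suc a) b + Σ-cross (suc a) b)
      ≡⟨ cong (_+_ (cross a (suc b) + cross a (suc b))) (twice-Σ-cross b (suc a)) ⟩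
    cross a (suc b) + cross a (suc b) + (+ suc a + 1ℤ) * (+ b + 1ℤ) * + central (suc (suc a)) * + central (suc b)
      ≡⟨ cross-step a b ⟩
    (+ a + 1ℤ) * (+ suc b + 1ℤ) * + central (suc a) * + central (suc (suc b)) ∎
    where
    S′ = ℤΣ.Σ-split b (λ i j → cross (a ℕ.+ suc i) j)
    shift : S′ ≡ Σ-cross (suc a) b
    shift = ℤΣ.Σ-split-cong b (λ i j _ → cong (λ k → cross k j) (ℕ.+-suc a i))
    regroup : ∀ p s → (p + s) + (p + s) ≡ p + p + (s + s)
    regroup = solve-∀

  pairConvolution : ℕ → ℕ → ℕ
  pairConvolution a b = ℕΣ.Σ-split b (convolution a)

  weight*pairConvolution : ∀ a b →
    weight (a ℕ.+ b) * + pairConvolution a b ≡ (+ a + 1ℤ) * (+ b + 1ℤ) * + central (suc a) * + central (suc b)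
  weight*pairConvolution a b = begin
    W * + pairConvolution a b
      ≡⟨ cong (W *_) (Σ-split-pos b (convolution a)) ⟩
    W * ℤΣ.Σ-split b (λ b₁ b₂ → + convolution a b₁ b₂)
      ≡⟨ ℤΣ.Σ-split-*ˡ b W (λ b₁ b₂ → + convolution a b₁ b₂) ⟨
    ℤΣ.Σ-split b (λ b₁ b₂ → W * + convolution a b₁ b₂)
      ≡⟨ ℤΣ.Σ-split-cong b (λ b₁ b₂ b₁+b₂≡b → trans (cong (λ k → weight k * + convolution a b₁ b₂)
                                                          (trans (cong (a ℕ.+_) (sym b₁+b₂≡b)) (sym (ℕ.+-assoc a b₁ b₂))))
                                                    (weight*convolution a b₁ b₂)) ⟩
    ℤΣ.Σ-split b (λ b₁ b₂ → cross (a ℕ.+ b₁) b₂ + cross (a ℕ.+ b₂) b₁)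
      ≡⟨ ℤΣ.Σ-split-+ b (λ b₁ b₂ → cross (a ℕ.+ b₁) b₂) (λ b₁ b₂ → cross (a ℕ.+ b₂) b₁) ⟩
    Σ-cross a b + ℤΣ.Σ-split b (λ b₁ b₂ → cross (a ℕ.+ b₂) b₁)
      ≡⟨ cong (_+_ (Σ-cross a b)) (ℤΣ.Σ-split-swap b (λ b₁ b₂ → cross (a ℕ.+ b₁) b₂)) ⟨
    Σ-cross a b + Σ-cross a b
      ≡⟨ twice-Σ-cross b a ⟩
    (+ a + 1ℤ) * (+ b + 1ℤ) * + central (suc a) * + central (suc b) ∎
    where
    W = weight (a ℕ.+ b)

  pairConvolution-central : ∀ a b →
    pairConvolution a b ℕ.* (2 ℕ.* suc (a ℕ.+ b) ℕ.* suc (suc (a ℕ.+ b)))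
    ≡ central (suc a) ℕ.* central (suc b) ℕ.* (suc a ℕ.* suc b)
  pairConvolution-central a b = +-injective (begin
    + (P ℕ.* w)                                   ≡⟨ pos-* P w ⟩
    + P * weight (a ℕ.+ b)                        ≡⟨ *-comm (+ P) (weight (a ℕ.+ b)) ⟩
    weight (a ℕ.+ b) * + P                        ≡⟨ weight*pairConvolution a b ⟩
    (+ a + 1ℤ) * (+ b + 1ℤ) * x * y               ≡⟨ regroup (+ a + 1ℤ) (+ b + 1ℤ) x y ⟩
    x * y * ((+ a + 1ℤ) * (+ b + 1ℤ))             ≡⟨ cong₂ (λ p q → x * y * (p * q)) (pos-suc a) (pos-suc b) ⟨
    x * y * (+ suc a * + suc b)                   ≡⟨ cong₂ _*_ (pos-* (central (suc a)) (central (suc b))) (pos-* (suc a) (suc b)) ⟨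
    + (central (suc a) ℕ.* central (suc b)) * + (suc a ℕ.* suc b)
                                                  ≡⟨ pos-* (central (suc a) ℕ.* central (suc b)) (suc a ℕ.* suc b) ⟨
    + (central (suc a) ℕ.* central (suc b) ℕ.* (suc a ℕ.* suc b)) ∎)
    where
    P = pairConvolution a b
    w = 2 ℕ.* suc (a ℕ.+ b) ℕ.* suc (suc (a ℕ.+ b))
    x = + central (suc a)
    y = + central (suc b)
    regroup : ∀ p q x y → p * q * x * y ≡ x * y * (p * q)
    regroup = solve-∀

module MaximalTrees where

  open import Defs
  open import Data.Nat
  open import Data.Nat.Properties
  open import Data.Nat.Tactic.RingSolver using (solve-∀)
  open import Data.List using (List; []; _∷_; _++_; length)
  open import Data.List.Properties using (length-++; ++-assoc)
  open import Data.List.Relation.Unary.Any using (Any; here; there)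
  open import Data.Product using (Σ; _×_; _,_; proj₁)
  open import Data.Sum using (_⊎_; inj₁; inj₂)
  open import Data.Unit using (⊤; tt)
  open import Data.Empty using (⊥-elim)
  open import Relation.Nullary using (¬_)
  open import Relation.Binary.PropositionalEquality
  open import Relation.Binary.Construct.Closure.Transitive using ([_]; _∷_)

  data Tight : Dir → Tree → Set where
    exterior   : ∀ {p} → Tight p leaf
    source     : ∀ {t} → Tight down t → Tight up (node ((down , t) ∷ []))
    out-parent : ∀ {l r} → Tight up l → Tight up r → Tight up (node ((up , l) ∷ (up , r) ∷ []))
    out-left   : ∀ {l r} → Tight down l → Tight up r → Tight down (node ((down , l) ∷ (up , r) ∷ []))
    out-right  : ∀ {l r} → Tight up l → Tight down r → Tight down (node ((up , l) ∷ (down , r) ∷ []))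

  valid-source : ∀ {t} → ValidBelow down t → ValidBelow up (node ((down , t) ∷ []))
  valid-source v = (λ ()) , inj₁ refl , (λ { _ _ refl () }) , v , tt

  valid-branching : ∀ {p c₁ c₂ cs} → HasOutgoing p (c₁ ∷ c₂ ∷ cs) → AllValid (c₁ ∷ c₂ ∷ cs) →
                    ValidBelow p (node (c₁ ∷ c₂ ∷ cs))
  valid-branching out v = (λ ()) , out , (λ { _ _ () }) , v

  tight⇒valid : ∀ {p t} → Tight p t → ValidBelow p t
  tight⇒valid exterior           = tt
  tight⇒valid (source h)         = valid-source (tight⇒valid h)
  tight⇒valid (out-parent h₁ h₂) = valid-branching (inj₁ refl) (tight⇒valid h₁ , tight⇒valid h₂ , tt)
  tight⇒valid (out-left h₁ h₂)   = valid-branching (inj₂ (here refl)) (tight⇒valid h₁ , tight⇒valid h₂ , tt)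
  tight⇒valid (out-right h₁ h₂)  = valid-branching (inj₂ (there (here refl))) (tight⇒valid h₁ , tight⇒valid h₂ , tt)

  isUp : Dir → ℕ
  isUp up   = 1
  isUp down = 0

  isDown : Dir → ℕ
  isDown up   = 0
  isDown down = 1

  countDown : List (Dir × Tree) → ℕ
  countDown []             = 0
  countDown ((d , _) ∷ cs) = isDown d + countDown cs

  outdegree : Dir → List (Dir × Tree) → ℕ
  outdegree p cs = isUp p + countDown cs

  -- (valence − 1) + out-degree of the interior vertex node cs
  charge : Dir → List (Dir × Tree) → ℕ
  charge p cs = length cs + outdegree p cs

  mutual
    chargeSum : Dir → Tree → ℕ
    chargeSum p leaf      = 0
    chargeSum p (node cs) = charge p cs + chargeSumAll cs

    chargeSumAll : List (Dir × Tree) → ℕ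
    chargeSumAll []             = 0
    chargeSumAll ((d , t) ∷ cs) = chargeSum d t + chargeSumAll cs

  mutual
    interiorCount : Tree → ℕ
    interiorCount leaf      = 0
    interiorCount (node cs) = suc (interiorCountAll cs)

    interiorCountAll : List (Dir × Tree) → ℕ
    interiorCountAll []             = 0
    interiorCountAll ((d , t) ∷ cs) = interiorCount t + interiorCountAll cs

  countDown-++ : ∀ xs ys → countDown (xs ++ ys) ≡ countDown xs + countDown ys
  countDown-++ []             ys = refl
  countDown-++ ((d , _) ∷ xs) ys = trans (cong (isDown d +_) (countDown-++ xs ys)) (sym (+-assoc (isDown d) _ _))

  chargeSumAll-++ : ∀ xs ys → chargeSumAll (xs ++ ys) ≡ chargeSumAll xs + chargeSumAll ys
  chargeSumAll-++ []             ys = refl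
  chargeSumAll-++ ((d , t) ∷ xs) ys = trans (cong (chargeSum d t +_) (chargeSumAll-++ xs ys)) (sym (+-assoc (chargeSum d t) _ _))

  interiorCountAll-++ : ∀ xs ys → interiorCountAll (xs ++ ys) ≡ interiorCountAll xs + interiorCountAll ys
  interiorCountAll-++ []             ys = refl
  interiorCountAll-++ ((d , t) ∷ xs) ys =
    trans (cong (interiorCount t +_) (interiorCountAll-++ xs ys)) (sym (+-assoc (interiorCount t) _ _))

  isUp+isDown≡1 : ∀ d → isUp d + isDown d ≡ 1
  isUp+isDown≡1 up   = refl
  isUp+isDown≡1 down = refl

  contract-interiorCount : ∀ {t t′} → Contract t t′ → interiorCount t ≡ suc (interiorCount t′)
  contract-interiorCount (here xs d ws ys) = cong suc (begin
    interiorCountAll (xs ++ (d , node ws) ∷ ys)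
      ≡⟨ interiorCountAll-++ xs _ ⟩
    interiorCountAll xs + suc (interiorCountAll ws + interiorCountAll ys)
      ≡⟨ +-suc (interiorCountAll xs) _ ⟩
    suc (interiorCountAll xs + (interiorCountAll ws + interiorCountAll ys))
      ≡⟨ cong (λ k → suc (interiorCountAll xs + k)) (interiorCountAll-++ ws ys) ⟨
    suc (interiorCountAll xs + interiorCountAll (ws ++ ys))
      ≡⟨ cong suc (interiorCountAll-++ xs (ws ++ ys)) ⟨
    suc (interiorCountAll (xs ++ ws ++ ys)) ∎)
    where open ≡-Reasoning
  contract-interiorCount (under xs d {t} {t′} ys c) = cong suc (begin
    interiorCountAll (xs ++ (d , t) ∷ ys)
      ≡⟨ interiorCountAll-++ xs _ ⟩
    interiorCountAll xs + (interiorCount t + interiorCountAll ys)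
      ≡⟨ cong (λ k → interiorCountAll xs + (k + interiorCountAll ys)) (contract-interiorCount c) ⟩
    interiorCountAll xs + suc (interiorCount t′ + interiorCountAll ys)
      ≡⟨ +-suc (interiorCountAll xs) _ ⟩
    suc (interiorCountAll xs + (interiorCount t′ + interiorCountAll ys))
      ≡⟨ cong suc (interiorCountAll-++ xs _) ⟨
    suc (interiorCountAll (xs ++ (d , t′) ∷ ys)) ∎)
    where open ≡-Reasoning

  contract-chargeSum : ∀ {t t′} → Contract t t′ → ∀ p → chargeSum p t ≡ 2 + chargeSum p t′
  contract-chargeSum (here xs d ws ys) p
    rewrite length-++ xs {(d , node ws) ∷ ys} | length-++ xs {ws ++ ys} | length-++ ws {ys}
          | countDown-++ xs ((d , node ws) ∷ ys) | countDown-++ xs (ws ++ ys) | countDown-++ ws ys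
          | chargeSumAll-++ xs ((d , node ws) ∷ ys) | chargeSumAll-++ xs (ws ++ ys) | chargeSumAll-++ ws ys
    = arithmetic (length xs) (length ws) (length ys) (isUp p) (countDown xs) (countDown ws) (countDown ys)
                 (chargeSumAll xs) (chargeSumAll ws) (chargeSumAll ys) (isUp d) (isDown d) (isUp+isDown≡1 d)
    where
    arithmetic : ∀ lx lw ly u dx dw dy sx sw sy ud dd → ud + dd ≡ 1 →
      lx + suc ly + (u + (dx + (dd + dy))) + (sx + (lw + (ud + dw) + sw + sy)) ≡
      2 + (lx + (lw + ly) + (u + (dx + (dw + dy))) + (sx + (sw + sy)))
    arithmetic lx lw ly u dx dw dy sx sw sy ud dd ud+dd≡1 =
      trans (regroup lx lw ly u dx dw dy sx sw sy ud dd) (cong (λ k → suc k + (lx + (lw + ly) + (u + (dx + (dw + dy))) + (sx + (sw + sy)))) ud+dd≡1)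
      where
      regroup : ∀ lx lw ly u dx dw dy sx sw sy ud dd →
        lx + suc ly + (u + (dx + (dd + dy))) + (sx + (lw + (ud + dw) + sw + sy)) ≡
        suc (ud + dd) + (lx + (lw + ly) + (u + (dx + (dw + dy))) + (sx + (sw + sy)))
      regroup = solve-∀
  contract-chargeSum (under xs d {t} {t′} ys c) p
    rewrite length-++ xs {(d , t) ∷ ys} | length-++ xs {(d , t′) ∷ ys}
          | countDown-++ xs ((d , t) ∷ ys) | countDown-++ xs ((d , t′) ∷ ys)
          | chargeSumAll-++ xs ((d , t) ∷ ys) | chargeSumAll-++ xs ((d , t′) ∷ ys) | contract-chargeSum c d
    = regroup (length xs + suc (length ys) + (isUp p + (countDown xs + (isDown d + countDown ys))))
              (chargeSumAll xs) (chargeSum d t′) (chargeSumAll ys)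
    where
    regroup : ∀ a b c e → a + (b + (2 + c + e)) ≡ 2 + (a + (b + (c + e)))
    regroup = solve-∀

  chargeSumᴬ : ATree → ℕ
  chargeSumᴬ (d , t) = chargeSum d t

  interiorCountᴬ : ATree → ℕ
  interiorCountᴬ (_ , t) = interiorCount t

  expansion-interiorCount : ∀ {T′ T} → IsEdgeExpansion T′ T → interiorCountᴬ T < interiorCountᴬ T′
  expansion-interiorCount [ _ , c ]       = ≤-reflexive (sym (contract-interiorCount c))
  expansion-interiorCount ((_ , c) ∷ cs) =
    subst (_ <_) (sym (contract-interiorCount c)) (m<n⇒m<1+n (expansion-interiorCount cs))

  expansion-chargeSum : ∀ {T′ T} → IsEdgeExpansion T′ T →
    chargeSumᴬ T′ + 2 * interiorCountᴬ T ≡ chargeSumᴬ T + 2 * interiorCountᴬ T′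
  expansion-chargeSum {d , t′} {_ , t} [ refl , c ]
    rewrite contract-chargeSum c d | contract-interiorCount c = shift (chargeSum d t) (interiorCount t)
    where
    shift : ∀ s k → 2 + s + 2 * k ≡ s + 2 * suc k
    shift = solve-∀
  expansion-chargeSum {d , t′} {T} ((refl , c) ∷ cs)
    rewrite contract-chargeSum c d | contract-interiorCount c =
    trans (cong (2 +_) (expansion-chargeSum cs)) (shift (chargeSumᴬ T) (interiorCount _))
    where
    shift : ∀ s k → 2 + (s + 2 * k) ≡ s + 2 * suc k
    shift = solve-∀

  hasOutgoing⇒outdegree≥1 : ∀ {p cs} → HasOutgoing p cs → 1 ≤ outdegree p cs
  hasOutgoing⇒outdegree≥1 (inj₁ refl) = s≤s z≤n
  hasOutgoing⇒outdegree≥1 {p} (inj₂ down∈) = ≤-trans (countDown≥1 down∈) (m≤n+m _ (isUp p))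
    where
    countDown≥1 : ∀ {cs} → Any (λ e → proj₁ e ≡ down) cs → 1 ≤ countDown cs
    countDown≥1 (here refl)           = s≤s z≤n
    countDown≥1 {(d , _) ∷ _} (there a) = ≤-trans (countDown≥1 a) (m≤n+m _ (isDown d))

  valid⇒charge≥3 : ∀ p cs → NonEmpty cs → HasOutgoing p cs → NotBivalentInOut p cs → 3 ≤ charge p cs
  valid⇒charge≥3 p    []                   ne out nb = ⊥-elim (ne refl)
  valid⇒charge≥3 up   ((up , t) ∷ [])      ne out nb = ⊥-elim (nb up t refl refl)
  valid⇒charge≥3 up   ((down , t) ∷ [])    ne out nb = s≤s (s≤s (s≤s z≤n))
  valid⇒charge≥3 down ((down , t) ∷ [])    ne out nb = ⊥-elim (nb down t refl refl)
  valid⇒charge≥3 down ((up , t) ∷ [])      ne out nb with hasOutgoing⇒outdegree≥1 out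
  ... | ()
  valid⇒charge≥3 p    (_ ∷ _ ∷ cs)        ne out nb =
    s≤s (s≤s (≤-trans (hasOutgoing⇒outdegree≥1 out) (m≤n+m _ (length cs))))

  mutual
    valid⇒3*interiorCount≤chargeSum : ∀ p t → ValidBelow p t → 3 * interiorCount t ≤ chargeSum p t
    valid⇒3*interiorCount≤chargeSum p leaf      _                    = z≤n
    valid⇒3*interiorCount≤chargeSum p (node cs) (ne , out , nb , vs) =
      subst (_≤ chargeSum p (node cs)) (sym (*-suc 3 (interiorCountAll cs)))
            (+-mono-≤ (valid⇒charge≥3 p cs ne out nb) (allValid⇒3*interiorCount≤chargeSum cs vs))

    allValid⇒3*interiorCount≤chargeSum : ∀ cs → AllValid cs → 3 * interiorCountAll cs ≤ chargeSumAll cs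
    allValid⇒3*interiorCount≤chargeSum []             _        = z≤n
    allValid⇒3*interiorCount≤chargeSum ((d , t) ∷ cs) (v , vs) =
      subst (_≤ chargeSum d t + chargeSumAll cs) (sym (*-distribˡ-+ 3 (interiorCount t) (interiorCountAll cs)))
            (+-mono-≤ (valid⇒3*interiorCount≤chargeSum d t v) (allValid⇒3*interiorCount≤chargeSum cs vs))

  private
    3+3a+3b≡3[1+a+b] : ∀ a b → 3 + (3 * a + (3 * b + 0)) ≡ 3 * suc (a + (b + 0))
    3+3a+3b≡3[1+a+b] = solve-∀

  tight⇒chargeSum≡3*interiorCount : ∀ {p t} → Tight p t → chargeSum p t ≡ 3 * interiorCount t
  tight⇒chargeSum≡3*interiorCount exterior = refl
  tight⇒chargeSum≡3*interiorCount (source {t} h)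
    rewrite tight⇒chargeSum≡3*interiorCount h = unary (interiorCount t)
    where
    unary : ∀ a → 3 + (3 * a + 0) ≡ 3 * suc (a + 0)
    unary = solve-∀
  tight⇒chargeSum≡3*interiorCount (out-parent {l} {r} h₁ h₂)
    rewrite tight⇒chargeSum≡3*interiorCount h₁ | tight⇒chargeSum≡3*interiorCount h₂ = 3+3a+3b≡3[1+a+b] (interiorCount l) (interiorCount r)
  tight⇒chargeSum≡3*interiorCount (out-left {l} {r} h₁ h₂)
    rewrite tight⇒chargeSum≡3*interiorCount h₁ | tight⇒chargeSum≡3*interiorCount h₂ = 3+3a+3b≡3[1+a+b] (interiorCount l) (interiorCount r)
  tight⇒chargeSum≡3*interiorCount (out-right {l} {r} h₁ h₂)
    rewrite tight⇒chargeSum≡3*interiorCount h₁ | tight⇒chargeSum≡3*interiorCount h₂ = 3+3a+3b≡3[1+a+b] (interiorCount l) (interiorCount r)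

  -- An expansion keeps chargeSum − 2·interiorCount fixed while adding interior vertices,
  -- which the bound 3·interiorCount ≤ chargeSum forbids once it is attained.
  tight⇒¬expansion : ∀ {d t d′ t′} → Tight d t → ValidBelow d′ t′ → ¬ IsEdgeExpansion (d′ , t′) (d , t)
  tight⇒¬expansion {d} {t} {d′} {t′} h v e = <⇒≱ (expansion-interiorCount e) (+-cancelʳ-≤ (2 * x′ + 2 * x) x′ x bound)
    where
    x = interiorCount t
    x′ = interiorCount t′
    bound : x′ + (2 * x′ + 2 * x) ≤ x + (2 * x′ + 2 * x)
    bound = subst₂ _≤_ (regroup₁ x x′)
                       (trans (expansion-chargeSum e) (trans (cong (_+ 2 * x′) (tight⇒chargeSum≡3*interiorCount h)) (regroup₂ x x′)))
                       (+-monoˡ-≤ (2 * x) (valid⇒3*interiorCount≤chargeSum d′ t′ v))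
      where
      regroup₁ : ∀ x x′ → 3 * x′ + 2 * x ≡ x′ + (2 * x′ + 2 * x)
      regroup₁ = solve-∀
      regroup₂ : ∀ x x′ → 3 * x + 2 * x′ ≡ x + (2 * x′ + 2 * x)
      regroup₂ = solve-∀

  Expandable : Dir → Tree → Set
  Expandable p t = Σ Tree λ t′ → Contract t′ t × ValidBelow p t′

  AllTight : List (Dir × Tree) → Set
  AllTight []             = ⊤
  AllTight ((d , t) ∷ cs) = Tight d t × AllTight cs

  ExpandableChild : List (Dir × Tree) → Set
  ExpandableChild cs = Σ (List (Dir × Tree)) λ xs → Σ Dir λ d → Σ Tree λ t → Σ (List (Dir × Tree)) λ ys →
    cs ≡ xs ++ (d , t) ∷ ys × Expandable d t

  valid-replace : ∀ {p} xs {d t t′} ys → ValidBelow p (node (xs ++ (d , t) ∷ ys)) → ValidBelow d t′ →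
                  ValidBelow p (node (xs ++ (d , t′) ∷ ys))
  valid-replace {p} xs {d} {t} {t′} ys (_ , out , nb , vs) v′ = nonEmpty xs , outgoing out , notBivalent xs ys nb , replace xs vs
    where
    nonEmpty : ∀ xs → NonEmpty (xs ++ (d , t′) ∷ ys)
    nonEmpty []      ()
    nonEmpty (_ ∷ _) ()
    anyDown : ∀ xs → Any (λ e → proj₁ e ≡ down) (xs ++ (d , t) ∷ ys) → Any (λ e → proj₁ e ≡ down) (xs ++ (d , t′) ∷ ys)
    anyDown []      (here e)  = here e
    anyDown []      (there a) = there a
    anyDown (_ ∷ _) (here e)  = here e
    anyDown (_ ∷ xs) (there a) = there (anyDown xs a)
    outgoing : HasOutgoing p (xs ++ (d , t) ∷ ys) → HasOutgoing p (xs ++ (d , t′) ∷ ys)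
    outgoing (inj₁ e) = inj₁ e
    outgoing (inj₂ a) = inj₂ (anyDown xs a)
    notBivalent : ∀ xs ys → NotBivalentInOut p (xs ++ (d , t) ∷ ys) → NotBivalentInOut p (xs ++ (d , t′) ∷ ys)
    notBivalent []          []      nb _ _ refl = nb d t refl
    notBivalent []          (_ ∷ _) nb _ _ ()
    notBivalent (_ ∷ [])    ys      nb _ _ ()
    notBivalent (_ ∷ _ ∷ _) ys      nb _ _ ()
    replace : ∀ xs → AllValid (xs ++ (d , t) ∷ ys) → AllValid (xs ++ (d , t′) ∷ ys)
    replace []             (_ , vs) = v′ , vs
    replace ((e , s) ∷ xs) (v , vs) = v , replace xs vs

  expand-first-two : ∀ {p} c₁ c₂ c₃ cs → HasOutgoing p (c₁ ∷ c₂ ∷ c₃ ∷ cs) → AllValid (c₁ ∷ c₂ ∷ c₃ ∷ cs) →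
                     Expandable p (node (c₁ ∷ c₂ ∷ c₃ ∷ cs))
  expand-first-two (down , t₁) c₂ c₃ cs out (v₁ , v₂ , vs) =
    _ , here [] down ((down , t₁) ∷ c₂ ∷ []) (c₃ ∷ cs) , valid-branching (inj₂ (here refl)) (valid-branching (inj₂ (here refl)) (v₁ , v₂ , tt) , vs)
  expand-first-two (up , t₁) (down , t₂) c₃ cs out (v₁ , v₂ , vs) =
    _ , here [] down ((up , t₁) ∷ (down , t₂) ∷ []) (c₃ ∷ cs) , valid-branching (inj₂ (here refl)) (valid-branching (inj₂ (there (here refl))) (v₁ , v₂ , tt) , vs)
  expand-first-two (up , t₁) (up , t₂) c₃ cs out (v₁ , v₂ , vs) =
    _ , here [] up ((up , t₁) ∷ (up , t₂) ∷ []) (c₃ ∷ cs) , valid-branching (outgoing out) (valid-branching (inj₁ refl) (v₁ , v₂ , tt) , vs)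
    where
    outgoing : ∀ {p} → HasOutgoing p ((up , t₁) ∷ (up , t₂) ∷ c₃ ∷ cs) → HasOutgoing p ((up , node ((up , t₁) ∷ (up , t₂) ∷ [])) ∷ c₃ ∷ cs)
    outgoing (inj₁ e)                 = inj₁ e
    outgoing (inj₂ (there (there a))) = inj₂ (there a)

  tight-or-expandable-vertex : ∀ p cs → ValidBelow p (node cs) → AllTight cs → Tight p (node cs) ⊎ Expandable p (node cs)
  tight-or-expandable-vertex p    []                   (ne , _) _ = ⊥-elim (ne refl)
  tight-or-expandable-vertex up   ((up , t) ∷ [])      (_ , _ , nb , _) _ = ⊥-elim (nb up t refl refl)
  tight-or-expandable-vertex down ((down , t) ∷ [])    (_ , _ , nb , _) _ = ⊥-elim (nb down t refl refl)
  tight-or-expandable-vertex down ((up , t) ∷ [])      (_ , out , _) _ with hasOutgoing⇒outdegree≥1 out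
  ... | ()
  tight-or-expandable-vertex down ((up , _) ∷ (up , _) ∷ []) (_ , out , _) _ with hasOutgoing⇒outdegree≥1 out
  ... | ()
  tight-or-expandable-vertex up   ((down , t) ∷ [])               _ (h , _)      = inj₁ (source h)
  tight-or-expandable-vertex up   ((up , l) ∷ (up , r) ∷ [])      _ (h₁ , h₂ , _) = inj₁ (out-parent h₁ h₂)
  tight-or-expandable-vertex down ((down , l) ∷ (up , r) ∷ [])    _ (h₁ , h₂ , _) = inj₁ (out-left h₁ h₂)
  tight-or-expandable-vertex down ((up , l) ∷ (down , r) ∷ [])    _ (h₁ , h₂ , _) = inj₁ (out-right h₁ h₂)
  tight-or-expandable-vertex up   ((up , t₁) ∷ (down , t₂) ∷ [])  (_ , _ , _ , v₁ , v₂ , _) _ =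
    inj₂ (_ , here ((up , t₁) ∷ []) up ((down , t₂) ∷ []) [] , valid-branching (inj₁ refl) (v₁ , valid-source v₂ , tt))
  tight-or-expandable-vertex up   ((down , t₁) ∷ (d₂ , t₂) ∷ [])  (_ , _ , _ , v₁ , v₂ , _) _ =
    inj₂ (_ , here [] up ((down , t₁) ∷ []) ((d₂ , t₂) ∷ []) , valid-branching (inj₁ refl) (valid-source v₁ , v₂ , tt))
  tight-or-expandable-vertex down ((down , t₁) ∷ (down , t₂) ∷ []) (_ , _ , _ , v₁ , v₂ , _) _ =
    inj₂ (_ , here [] up ((down , t₁) ∷ []) ((down , t₂) ∷ []) ,
          valid-branching (inj₂ (there (here refl))) (valid-source v₁ , v₂ , tt))
  tight-or-expandable-vertex p (c₁ ∷ c₂ ∷ c₃ ∷ cs) (_ , out , _ , vs) _ = inj₂ (expand-first-two c₁ c₂ c₃ cs out vs)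

  mutual
    tight-or-expandable : ∀ p t → ValidBelow p t → Tight p t ⊎ Expandable p t
    tight-or-expandable p leaf      _ = inj₁ exterior
    tight-or-expandable p (node cs) v@(_ , _ , _ , vs) with tight-or-expandable-children cs vs
    ... | inj₁ tights = tight-or-expandable-vertex p cs v tights
    ... | inj₂ (xs , d , t , ys , refl , t′ , c , v′) = inj₂ (_ , under xs d ys c , valid-replace xs ys v v′)

    tight-or-expandable-children : ∀ cs → AllValid cs → AllTight cs ⊎ ExpandableChild cs
    tight-or-expandable-children []             _        = inj₁ tt
    tight-or-expandable-children ((d , t) ∷ cs) (v , vs) with tight-or-expandable d t v
    ... | inj₂ e = inj₂ ([] , d , t , cs , refl , e)
    ... | inj₁ h with tight-or-expandable-children cs vs
    ...   | inj₁ hs                            = inj₁ (h , hs)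
    ...   | inj₂ (xs , d′ , t′ , ys , refl , e) = inj₂ ((d , t) ∷ xs , d′ , t′ , ys , refl , e)

  labelsBelow : Dir → Tree → List Label
  labelsBelow d leaf      = childLabel d ∷ []
  labelsBelow d (node cs) = leafLabels cs

  leafLabels-∷ : ∀ d t cs → leafLabels ((d , t) ∷ cs) ≡ labelsBelow d t ++ leafLabels cs
  leafLabels-∷ d leaf      cs = refl
  leafLabels-∷ d (node ws) cs = refl

  leafLabels-++ : ∀ xs ys → leafLabels (xs ++ ys) ≡ leafLabels xs ++ leafLabels ys
  leafLabels-++ []             ys = refl
  leafLabels-++ ((d , t) ∷ xs) ys = begin
    leafLabels ((d , t) ∷ xs ++ ys)                   ≡⟨ leafLabels-∷ d t (xs ++ ys) ⟩
    labelsBelow d t ++ leafLabels (xs ++ ys)          ≡⟨ cong (labelsBelow d t ++_) (leafLabels-++ xs ys) ⟩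
    labelsBelow d t ++ leafLabels xs ++ leafLabels ys ≡⟨ ++-assoc (labelsBelow d t) _ _ ⟨
    (labelsBelow d t ++ leafLabels xs) ++ leafLabels ys ≡⟨ cong (_++ leafLabels ys) (leafLabels-∷ d t xs) ⟨
    leafLabels ((d , t) ∷ xs) ++ leafLabels ys       ∎
    where open ≡-Reasoning

  contract-leafLabels : ∀ {cs cs′} → Contract (node cs) (node cs′) → leafLabels cs ≡ leafLabels cs′
  contract-leafLabels (here xs d ws ys) = begin
    leafLabels (xs ++ (d , node ws) ∷ ys)          ≡⟨ leafLabels-++ xs _ ⟩
    leafLabels xs ++ leafLabels ws ++ leafLabels ys ≡⟨ cong (leafLabels xs ++_) (leafLabels-++ ws ys) ⟨
    leafLabels xs ++ leafLabels (ws ++ ys)          ≡⟨ leafLabels-++ xs (ws ++ ys) ⟨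
    leafLabels (xs ++ ws ++ ys)                     ∎
    where open ≡-Reasoning
  contract-leafLabels (under xs d {t} {t′} ys c) = begin
    leafLabels (xs ++ (d , t) ∷ ys)                      ≡⟨ leafLabels-++ xs _ ⟩
    leafLabels xs ++ leafLabels ((d , t) ∷ ys)           ≡⟨ cong (leafLabels xs ++_) (leafLabels-∷ d t ys) ⟩
    leafLabels xs ++ labelsBelow d t ++ leafLabels ys    ≡⟨ cong (λ w → leafLabels xs ++ w ++ leafLabels ys) (below c) ⟩
    leafLabels xs ++ labelsBelow d t′ ++ leafLabels ys   ≡⟨ cong (leafLabels xs ++_) (leafLabels-∷ d t′ ys) ⟨
    leafLabels xs ++ leafLabels ((d , t′) ∷ ys)          ≡⟨ leafLabels-++ xs _ ⟨
    leafLabels (xs ++ (d , t′) ∷ ys)                     ∎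
    where
    open ≡-Reasoning
    below : ∀ {t t′} → Contract t t′ → labelsBelow d t ≡ labelsBelow d t′
    below c@(here _ _ _ _)    = contract-leafLabels c
    below c@(under _ _ _ _) = contract-leafLabels c

  maximallyExpanded⇒tight : ∀ α d t → MaximallyExpanded α (d , t) → Tight d t
  maximallyExpanded⇒tight α d t ((interior , v , labels≡α) , maximal) with tight-or-expandable d t v
  ... | inj₁ h = h
  maximallyExpanded⇒tight α d (node cs) ((_ , v , labels≡α) , maximal) | inj₂ (node cs′ , c , v′) =
    ⊥-elim (maximal ((d , node cs′) , ((cs′ , refl) , v′ , trans (cong (rootLabel d ∷_) (contract-leafLabels c)) labels≡α) , [ refl , c ]))

  tight⇒maximallyExpanded : ∀ α d t → IsAlphaTree α (d , t) → Tight d t → MaximallyExpanded α (d , t)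
  tight⇒maximallyExpanded α d t T h = T , λ { (_ , (_ , v′ , _) , e) → tight⇒¬expansion h v′ e }

module LabelWords where

  open import Defs using (Label; In; Out)
  open import Data.Nat
  open import Data.Nat.Properties
  open import Data.List using (List; []; _∷_; _++_; length; replicate)
  open import Data.List.Properties using (++-assoc; length-replicate; length-++)
  open import Data.Product using (∃; _×_; _,_)
  open import Relation.Binary.PropositionalEquality

  outCount : List Label → ℕ
  outCount []        = 0
  outCount (In ∷ w)  = outCount w
  outCount (Out ∷ w) = suc (outCount w)

  ins : ℕ → List Label
  ins n = replicate n In

  oneOut : ℕ → ℕ → List Label
  oneOut a b = ins a ++ Out ∷ ins b

  outCount-++ : ∀ xs ys → outCount (xs ++ ys) ≡ outCount xs + outCount ys
  outCount-++ []         ys = refl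
  outCount-++ (In ∷ xs)  ys = outCount-++ xs ys
  outCount-++ (Out ∷ xs) ys = cong suc (outCount-++ xs ys)

  outCount-ins : ∀ n → outCount (ins n) ≡ 0
  outCount-ins zero    = refl
  outCount-ins (suc n) = outCount-ins n

  outCount-oneOut : ∀ a b → outCount (oneOut a b) ≡ 1
  outCount-oneOut zero    b = cong suc (outCount-ins b)
  outCount-oneOut (suc a) b = outCount-oneOut a b

  outCount≡0⇒ins : ∀ w → outCount w ≡ 0 → w ≡ ins (length w)
  outCount≡0⇒ins []        _ = refl
  outCount≡0⇒ins (In ∷ w)  e = cong (In ∷_) (outCount≡0⇒ins w e)

  outCount≡1⇒oneOut : ∀ w → outCount w ≡ 1 → ∃ λ a → ∃ λ b → w ≡ oneOut a b
  outCount≡1⇒oneOut (In ∷ w)  e with outCount≡1⇒oneOut w e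
  ... | a , b , refl = suc a , b , refl
  outCount≡1⇒oneOut (Out ∷ w) e = 0 , length w , cong (Out ∷_) (outCount≡0⇒ins w (suc-injective e))

  ins-++ : ∀ a b → ins a ++ ins b ≡ ins (a + b)
  ins-++ zero    b = refl
  ins-++ (suc a) b = cong (In ∷_) (ins-++ a b)

  oneOut-++-ins : ∀ a b j → oneOut a b ++ ins j ≡ oneOut a (b + j)
  oneOut-++-ins a b j = trans (++-assoc (ins a) (Out ∷ ins b) (ins j)) (cong (λ w → ins a ++ Out ∷ w) (ins-++ b j))

  ins-++-oneOut : ∀ j a b → ins j ++ oneOut a b ≡ oneOut (j + a) b
  ins-++-oneOut j a b = trans (sym (++-assoc (ins j) (ins a) (Out ∷ ins b))) (cong (_++ Out ∷ ins b) (ins-++ j a))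

  beforeOut : List Label → ℕ
  beforeOut []        = 0
  beforeOut (In ∷ w)  = suc (beforeOut w)
  beforeOut (Out ∷ w) = 0

  afterOut : List Label → ℕ
  afterOut []        = 0
  afterOut (In ∷ w)  = afterOut w
  afterOut (Out ∷ w) = length w

  beforeOut-oneOut : ∀ a b → beforeOut (oneOut a b) ≡ a
  beforeOut-oneOut zero    b = refl
  beforeOut-oneOut (suc a) b = cong suc (beforeOut-oneOut a b)

  afterOut-oneOut : ∀ a b → afterOut (oneOut a b) ≡ b
  afterOut-oneOut zero    b = length-replicate b
  afterOut-oneOut (suc a) b = afterOut-oneOut a b

  oneOut-injective : ∀ {a b a′ b′} → oneOut a b ≡ oneOut a′ b′ → a ≡ a′ × b ≡ b′
  oneOut-injective {a} {b} {a′} {b′} e =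
    trans (sym (beforeOut-oneOut a b)) (trans (cong beforeOut e) (beforeOut-oneOut a′ b′)) ,
    trans (sym (afterOut-oneOut a b)) (trans (cong afterOut e) (afterOut-oneOut a′ b′))

  length-ins : ∀ n → length (ins n) ≡ n
  length-ins n = length-replicate n

  length-oneOut : ∀ a b → length (oneOut a b) ≡ a + suc b
  length-oneOut a b = trans (length-++ (ins a)) (cong₂ _+_ (length-replicate a) (cong suc (length-replicate b)))

  split-oneOut-left : ∀ xs ys {a b} → xs ++ ys ≡ oneOut a b → outCount ys ≡ 0 →
    ∃ λ b₁ → ∃ λ j → xs ≡ oneOut a b₁ × ys ≡ ins j × b₁ + j ≡ b
  split-oneOut-left xs ys {a} {b} e ys-ins with outCount≡1⇒oneOut xs xs-one
    where
    xs-one : outCount xs ≡ 1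
    xs-one = begin
      outCount xs                   ≡⟨ +-identityʳ _ ⟨
      outCount xs + 0               ≡⟨ cong (outCount xs +_) ys-ins ⟨
      outCount xs + outCount ys     ≡⟨ outCount-++ xs ys ⟨
      outCount (xs ++ ys)           ≡⟨ cong outCount e ⟩
      outCount (oneOut a b)         ≡⟨ outCount-oneOut a b ⟩
      1                             ∎
      where open ≡-Reasoning
  ... | a′ , b₁ , refl with oneOut-injective (trans (sym (oneOut-++-ins a′ b₁ (length ys)))
                                                   (trans (cong (oneOut a′ b₁ ++_) (sym (outCount≡0⇒ins ys ys-ins))) e))
  ... | refl , b₁+j≡b = b₁ , length ys , refl , outCount≡0⇒ins ys ys-ins , b₁+j≡b

  split-oneOut-right : ∀ xs ys {a b} → xs ++ ys ≡ oneOut a b → outCount xs ≡ 0 →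
    ∃ λ j → ∃ λ a₁ → xs ≡ ins j × ys ≡ oneOut a₁ b × j + a₁ ≡ a
  split-oneOut-right xs ys {a} {b} e xs-ins with outCount≡1⇒oneOut ys ys-one
    where
    ys-one : outCount ys ≡ 1
    ys-one = begin
      outCount ys                   ≡⟨ cong (_+ outCount ys) xs-ins ⟨
      outCount xs + outCount ys     ≡⟨ outCount-++ xs ys ⟨
      outCount (xs ++ ys)           ≡⟨ cong outCount e ⟩
      outCount (oneOut a b)         ≡⟨ outCount-oneOut a b ⟩
      1                             ∎
      where open ≡-Reasoning
  ... | a₁ , b′ , refl with oneOut-injective (trans (sym (ins-++-oneOut (length xs) a₁ b′))
                                                   (trans (cong (_++ oneOut a₁ b′) (sym (outCount≡0⇒ins xs xs-ins))) e))
  ... | j+a₁≡a , refl = length xs , a₁ , outCount≡0⇒ins xs xs-ins , refl , j+a₁≡a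

module Splits where

  open import Data.Nat
  import Data.Nat.Properties as ℕ
  open import Data.List using (List; []; _∷_; map; length; concat; concatMap; cartesianProductWith)
  open import Data.List.Properties using (length-++; length-map; map-∘)
  open import Data.List.Membership.Propositional using (_∈_; lose; find)
  open import Data.List.Membership.Propositional.Properties using (∈-concatMap⁺; ∈-concatMap⁻; ∈-map⁺; ∈-map⁻)
  open import Data.List.Relation.Unary.Any using (here; there)
  import Data.List.Relation.Unary.All as All
  open import Data.List.Relation.Unary.AllPairs using ([]; _∷_)
  open import Data.List.Relation.Unary.Unique.Propositional using (Unique)
  open import Data.List.Relation.Unary.Unique.Propositional.Properties using (++⁺; map⁺)
  open import Data.Product using (∃; _×_; _,_; proj₁; proj₂; map₁)
  open import Function using (_∘_)
  open import Data.Empty using (⊥)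
  open import Relation.Binary.PropositionalEquality


  module _ {A B : Set} (f : A → List B) where

    ∈-concatMap⁺′ : ∀ {xs x y} → x ∈ xs → y ∈ f x → y ∈ concatMap f xs
    ∈-concatMap⁺′ {y = y} x∈xs y∈fx = ∈-concatMap⁺ f (lose {P = (y ∈_) ∘ f} x∈xs y∈fx)

    ∈-concatMap⁻′ : ∀ xs {y} → y ∈ concatMap f xs → ∃ λ x → x ∈ xs × y ∈ f x
    ∈-concatMap⁻′ xs y∈ = find (∈-concatMap⁻ f {xs} y∈)

    unique-concatMap : ∀ {xs} (g : B → A) → Unique xs → (∀ {x} → x ∈ xs → Unique (f x)) →
                       (∀ {x y} → x ∈ xs → y ∈ f x → g y ≡ x) → Unique (concatMap f xs)
    unique-concatMap {[]}     g _              _       _      = []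
    unique-concatMap {x ∷ xs} g (x∉xs ∷ uxs) unique-f g-inv =
      ++⁺ (unique-f (here refl))
          (unique-concatMap g uxs (unique-f ∘ there) (g-inv ∘ there))
          disjoint
      where
      disjoint : ∀ {v} → v ∈ f x × v ∈ concatMap f xs → ⊥
      disjoint (v∈fx , v∈rest) with ∈-concatMap⁻′ xs v∈rest
      ... | x′ , x′∈xs , v∈fx′ = All.lookup x∉xs x′∈xs (trans (sym (g-inv (here refl) v∈fx)) (g-inv (there x′∈xs) v∈fx′))

  length-cartesianProductWith : ∀ {A B C : Set} (f : A → B → C) xs ys →
                                length (cartesianProductWith f xs ys) ≡ length xs * length ys
  length-cartesianProductWith f []       ys = refl
  length-cartesianProductWith f (x ∷ xs) ys =
    trans (length-++ (map (f x) ys)) (cong₂ _+_ (length-map (f x) ys) (length-cartesianProductWith f xs ys))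

  splits : ℕ → List (ℕ × ℕ)
  splits zero    = (0 , 0) ∷ []
  splits (suc n) = (0 , suc n) ∷ map (map₁ suc) (splits n)

  ∈-splits⁺ : ∀ i j → (i , j) ∈ splits (i + j)
  ∈-splits⁺ zero    zero    = here refl
  ∈-splits⁺ zero    (suc j) = here refl
  ∈-splits⁺ (suc i) j       = there (∈-map⁺ (map₁ suc) (∈-splits⁺ i j))

  ∈-splits⁻ : ∀ n {p} → p ∈ splits n → proj₁ p + proj₂ p ≡ n
  ∈-splits⁻ zero    (here refl) = refl
  ∈-splits⁻ (suc n) (here refl) = refl
  ∈-splits⁻ (suc n) (there p∈)  with ∈-map⁻ (map₁ suc) p∈
  ... | (i , j) , q∈ , refl = cong suc (∈-splits⁻ n q∈)

  ∈-splits : ∀ {i j n} → i + j ≡ n → (i , j) ∈ splits n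
  ∈-splits {i} {j} refl = ∈-splits⁺ i j

  unique-splits : ∀ n → Unique (splits n)
  unique-splits zero    = All.[] ∷ []
  unique-splits (suc n) = All.tabulate fresh ∷ map⁺ suc-injective (unique-splits n)
    where
    suc-injective : ∀ {p q : ℕ × ℕ} → map₁ suc p ≡ map₁ suc q → p ≡ q
    suc-injective {_ , _} {_ , _} refl = refl
    fresh : ∀ {q} → q ∈ map (map₁ suc) (splits n) → (0 , suc n) ≢ q
    fresh q∈ refl with ∈-map⁻ (map₁ suc) q∈
    ... | _ , _ , ()

  length-concatMap-splits : ∀ {B : Set} n (f : ℕ × ℕ → List B) →
                            length (concatMap f (splits n)) ≡ ℕΣ.Σ-split n (λ i j → length (f (i , j)))
  length-concatMap-splits zero    f = trans (length-++ (f (0 , 0))) (ℕ.+-identityʳ _)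
  length-concatMap-splits (suc n) f = trans (length-++ (f (0 , suc n))) (cong (length (f (0 , suc n)) +_) (begin
    length (concatMap f (map (map₁ suc) (splits n)))   ≡⟨ cong (length ∘ concat) (map-∘ (splits n)) ⟨
    length (concatMap (f ∘ map₁ suc) (splits n))       ≡⟨ length-concatMap-splits n (f ∘ map₁ suc) ⟩
    ℕΣ.Σ-split n (λ i j → length (f (suc i , j)))      ∎))
    where open ≡-Reasoning

module Enumeration where

  open import Defs
  open MaximalTrees using (Tight; exterior; source; out-parent; out-left; out-right; isDown; labelsBelow; leafLabels-∷)
  open LabelWords
  open Splits
  open import Data.Bool using (Bool; true; false; if_then_else_; _∨_)
  open import Data.Nat
  open import Data.Nat.Properties
  import Data.Nat.Tactic.RingSolver
  open import Data.List using (List; []; _∷_; _++_; map; length; concatMap; cartesianProductWith)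
  open import Data.List.Properties using (++-identityʳ; length-++)
  open import Data.List.Membership.Propositional using (_∈_)
  open import Data.List.Membership.Propositional.Properties
    using (∈-++⁺ˡ; ∈-++⁺ʳ; ∈-++⁻; ∈-map⁺; ∈-map⁻; ∈-cartesianProductWith⁺; ∈-cartesianProductWith⁻)
  open import Data.List.Relation.Unary.Any using (here)
  open import Data.List.Relation.Unary.AllPairs using ([]; _∷_)
  open import Data.List.Relation.Unary.All using ([])
  open import Data.List.Relation.Unary.Unique.Propositional using (Unique)
  open import Data.List.Relation.Unary.Unique.Propositional.Properties using (++⁺; map⁺; cartesianProductWith⁺)
  open import Data.Product using (∃; _×_; _,_; proj₁; proj₂)
  open import Data.Sum using (_⊎_; inj₁; inj₂)
  open import Data.Empty using (⊥; ⊥-elim)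
  open import Relation.Nullary using (¬_)
  open import Relation.Binary.PropositionalEquality

  sourceNode : Tree → Tree
  sourceNode s = node ((down , s) ∷ [])

  outParentNode outLeftNode outRightNode : Tree → Tree → Tree
  outParentNode l r = node ((up , l) ∷ (up , r) ∷ [])
  outLeftNode   l r = node ((down , l) ∷ (up , r) ∷ [])
  outRightNode  l r = node ((up , l) ∷ (down , r) ∷ [])

  leafLabels-unary : ∀ d t → leafLabels ((d , t) ∷ []) ≡ labelsBelow d t
  leafLabels-unary d t = trans (leafLabels-∷ d t []) (++-identityʳ (labelsBelow d t))

  leafLabels-binary : ∀ d₁ t₁ d₂ t₂ → leafLabels ((d₁ , t₁) ∷ (d₂ , t₂) ∷ []) ≡ labelsBelow d₁ t₁ ++ labelsBelow d₂ t₂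
  leafLabels-binary d₁ t₁ d₂ t₂ = trans (leafLabels-∷ d₁ t₁ _) (cong (labelsBelow d₁ t₁ ++_) (leafLabels-unary d₂ t₂))

  leafCount : Tree → ℕ
  leafCount t = length (labelsBelow up t)

  firstChild secondChild : Tree → Tree
  firstChild (node ((_ , t) ∷ _)) = t
  firstChild _                    = leaf
  secondChild (node (_ ∷ (_ , t) ∷ _)) = t
  secondChild _                        = leaf

  containsSource : Tree → Bool
  containsSource (node (_ ∷ []))                 = true
  containsSource (node ((_ , l) ∷ (_ , r) ∷ [])) = containsSource l ∨ containsSource r
  containsSource _                               = false

  -- numbers of leaves to the left and to the right of the path from the root to the source
  spineLeft spineRight : Tree → ℕ
  spineLeft (node ((up , l) ∷ (up , r) ∷ [])) = if containsSource l then spineLeft l else leafCount l + spineLeft r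
  spineLeft _                                 = 0
  spineRight (node ((up , l) ∷ (up , r) ∷ [])) = if containsSource l then spineRight l + leafCount r else spineRight r
  spineRight _                                 = 0

  sources : ∀ {p t} → Tight p t → ℕ
  sources exterior           = 0
  sources (source h)         = suc (sources h)
  sources (out-parent h₁ h₂) = sources h₁ + sources h₂
  sources (out-left h₁ h₂)   = sources h₁ + sources h₂
  sources (out-right h₁ h₂)  = sources h₁ + sources h₂

  length-leafLabels-binary : ∀ d₁ t₁ d₂ t₂ →
    length (leafLabels ((d₁ , t₁) ∷ (d₂ , t₂) ∷ [])) ≡ length (labelsBelow d₁ t₁) + length (labelsBelow d₂ t₂)
  length-leafLabels-binary d₁ t₁ d₂ t₂ = trans (cong length (leafLabels-binary d₁ t₁ d₂ t₂)) (length-++ (labelsBelow d₁ t₁))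

  labelsBelow-nonEmpty : ∀ {p t} → Tight p t → 1 ≤ length (labelsBelow p t)
  labelsBelow-nonEmpty exterior                  = s≤s z≤n
  labelsBelow-nonEmpty (source {s} h)            =
    subst (1 ≤_) (sym (cong length (leafLabels-unary down s))) (labelsBelow-nonEmpty h)
  labelsBelow-nonEmpty (out-parent {l} {r} h₁ _) =
    subst (1 ≤_) (sym (length-leafLabels-binary up l up r)) (≤-trans (labelsBelow-nonEmpty h₁) (m≤m+n _ _))
  labelsBelow-nonEmpty (out-left {l} {r} h₁ _)   =
    subst (1 ≤_) (sym (length-leafLabels-binary down l up r)) (≤-trans (labelsBelow-nonEmpty h₁) (m≤m+n _ _))
  labelsBelow-nonEmpty (out-right {l} {r} h₁ _)  =
    subst (1 ≤_) (sym (length-leafLabels-binary up l down r)) (≤-trans (labelsBelow-nonEmpty h₁) (m≤m+n _ _))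

  -- fuel that suffices to enumerate a tight tree
  measure : ∀ {p t} → Tight p t → ℕ
  measure {p} {t} h = length (labelsBelow p t) + sources h

  measure-pos : ∀ {d t} (h : Tight d t) → 1 ≤ measure h
  measure-pos h = ≤-trans (labelsBelow-nonEmpty h) (m≤m+n _ _)

  no-fuel : ∀ {d t} (h : Tight d t) → ¬ measure h ≤ 0
  no-fuel h le with ≤-trans (measure-pos h) le
  ... | ()

  measure-children : ∀ {d₁ t₁ d₂ t₂ f} (h₁ : Tight d₁ t₁) (h₂ : Tight d₂ t₂) →
    length (leafLabels ((d₁ , t₁) ∷ (d₂ , t₂) ∷ [])) + (sources h₁ + sources h₂) ≤ suc f →
    measure h₁ ≤ f × measure h₂ ≤ f
  measure-children {d₁} {t₁} {d₂} {t₂} {f} h₁ h₂ le =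
    shrink (measure h₁) (measure h₂) (measure-pos h₂) total≤ ,
    shrink (measure h₂) (measure h₁) (measure-pos h₁) (subst (_≤ suc f) (+-comm (measure h₁) (measure h₂)) total≤)
    where
    total≤ : measure h₁ + measure h₂ ≤ suc f
    total≤ = subst (_≤ suc f) (trans (cong (_+ (sources h₁ + sources h₂)) (length-leafLabels-binary d₁ t₁ d₂ t₂))
                                     (regroup (length (labelsBelow d₁ t₁)) (length (labelsBelow d₂ t₂)) (sources h₁) (sources h₂))) le
      where
      regroup : ∀ a b c d → a + b + (c + d) ≡ a + c + (b + d)
      regroup = Data.Nat.Tactic.RingSolver.solve-∀
    shrink : ∀ m n → 1 ≤ n → m + n ≤ suc f → m ≤ f
    shrink m n 1≤n le = ≤-pred (≤-trans (subst (_≤ m + n) (+-comm m 1) (+-monoʳ-≤ m 1≤n)) le)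

  outCount-leafLabels-binary : ∀ d₁ t₁ d₂ t₂ →
    outCount (leafLabels ((d₁ , t₁) ∷ (d₂ , t₂) ∷ [])) ≡ outCount (labelsBelow d₁ t₁) + outCount (labelsBelow d₂ t₂)
  outCount-leafLabels-binary d₁ t₁ d₂ t₂ = trans (cong outCount (leafLabels-binary d₁ t₁ d₂ t₂)) (outCount-++ (labelsBelow d₁ t₁) _)

  private
    interchange : ∀ a b c d → a + c + (b + d) ≡ a + b + (c + d)
    interchange = Data.Nat.Tactic.RingSolver.solve-∀

  outCount-labelsBelow : ∀ {p t} (h : Tight p t) → outCount (labelsBelow p t) ≡ sources h + isDown p
  outCount-labelsBelow {up}   exterior = refl
  outCount-labelsBelow {down} exterior = refl
  outCount-labelsBelow (source {s} h) =
    trans (cong outCount (leafLabels-unary down s)) (trans (outCount-labelsBelow h) (trans (+-comm (sources h) 1) (sym (+-identityʳ _))))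
  outCount-labelsBelow (out-parent {l} {r} h₁ h₂) =
    trans (outCount-leafLabels-binary up l up r) (trans (cong₂ _+_ (outCount-labelsBelow h₁) (outCount-labelsBelow h₂)) (interchange (sources h₁) (sources h₂) 0 0))
  outCount-labelsBelow (out-left {l} {r} h₁ h₂) =
    trans (outCount-leafLabels-binary down l up r) (trans (cong₂ _+_ (outCount-labelsBelow h₁) (outCount-labelsBelow h₂)) (interchange (sources h₁) (sources h₂) 1 0))
  outCount-labelsBelow (out-right {l} {r} h₁ h₂) =
    trans (outCount-leafLabels-binary up l down r) (trans (cong₂ _+_ (outCount-labelsBelow h₁) (outCount-labelsBelow h₂)) (interchange (sources h₁) (sources h₂) 0 1))

  AllIns : ℕ → Tree → Set
  AllIns n t = Tight up t × labelsBelow up t ≡ ins n × containsSource t ≡ false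

  singleLeaf : ℕ → List Tree
  singleLeaf 1 = leaf ∷ []
  singleLeaf _ = []

  -- the tight up-trees with n leaves, all labelled In (given enough fuel f)
  mutual
    upIns : ℕ → ℕ → List Tree
    upIns zero    n = []
    upIns (suc f) n = singleLeaf n ++ concatMap (upInsNodes f) (splits n)

    upInsNodes : ℕ → ℕ × ℕ → List Tree
    upInsNodes f (i , j) = cartesianProductWith outParentNode (upIns f i) (upIns f j)

  ∈-upIns-leaf : ∀ f → leaf ∈ upIns (suc f) 1
  ∈-upIns-leaf f = here refl

  ∈-upIns-node : ∀ {f i j n l r} → l ∈ upIns f i → r ∈ upIns f j → i + j ≡ n → outParentNode l r ∈ upIns (suc f) n
  ∈-upIns-node {f} {n = n} l∈ r∈ i+j≡n =
    ∈-++⁺ʳ (singleLeaf n) (∈-concatMap⁺′ _ (∈-splits i+j≡n) (∈-cartesianProductWith⁺ outParentNode l∈ r∈))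

  singleLeaf-sound : ∀ n {t} → t ∈ singleLeaf n → t ≡ leaf × n ≡ 1
  singleLeaf-sound 1 (here refl) = refl , refl

  upIns-sound : ∀ f n {t} → t ∈ upIns f n → AllIns n t
  upIns-sound (suc f) n t∈ with ∈-++⁻ (singleLeaf n) t∈
  ... | inj₁ t∈₁ with singleLeaf-sound n t∈₁
  ...   | refl , refl = exterior , refl , refl
  upIns-sound (suc f) n t∈ | inj₂ t∈₂ with ∈-concatMap⁻′ _ (splits n) t∈₂
  ... | (i , j) , ij∈ , t∈ₚ with ∈-cartesianProductWith⁻ outParentNode (upIns f i) (upIns f j) t∈ₚ
  ...   | l , r , l∈ , r∈ , refl with upIns-sound f i l∈ | upIns-sound f j r∈
  ...     | hₗ , eₗ , sₗ | hᵣ , eᵣ , sᵣ = out-parent hₗ hᵣ , labels≡ins , cong₂ _∨_ sₗ sᵣ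
    where
    labels≡ins : labelsBelow up (outParentNode l r) ≡ ins n
    labels≡ins = trans (leafLabels-binary up l up r)
                   (trans (cong₂ _++_ eₗ eᵣ) (trans (ins-++ i j) (cong ins (∈-splits⁻ n ij∈))))

  leafCount-ins : ∀ {n} t → labelsBelow up t ≡ ins n → leafCount t ≡ n
  leafCount-ins {n} t e = trans (cong length e) (length-ins n)

  outParentNode-injective : ∀ {l l′ r r′} → outParentNode l r ≡ outParentNode l′ r′ → l ≡ l′ × r ≡ r′
  outParentNode-injective refl = refl , refl

  leafCounts : Tree → ℕ × ℕ
  leafCounts t = leafCount (firstChild t) , leafCount (secondChild t)

  upIns-unique : ∀ f n → Unique (upIns f n)
  upIns-unique zero    n = []
  upIns-unique (suc f) n = ++⁺ (singleLeaf-unique n) products-unique disjoint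
    where
    singleLeaf-unique : ∀ n → Unique (singleLeaf n)
    singleLeaf-unique 0             = []
    singleLeaf-unique 1             = [] ∷ []
    singleLeaf-unique (suc (suc _)) = []
    products-unique : Unique (concatMap (upInsNodes f) (splits n))
    products-unique = unique-concatMap _ leafCounts (unique-splits n)
      (λ _ → cartesianProductWith⁺ outParentNode outParentNode-injective (upIns-unique f _) (upIns-unique f _))
      decode
      where
      decode : ∀ {p t} → p ∈ splits n → t ∈ cartesianProductWith outParentNode (upIns f (proj₁ p)) (upIns f (proj₂ p)) →
               leafCounts t ≡ p
      decode {i , j} _ t∈ with ∈-cartesianProductWith⁻ outParentNode (upIns f i) (upIns f j) t∈
      ... | l , r , l∈ , r∈ , refl =
        cong₂ _,_ (leafCount-ins l (proj₁ (proj₂ (upIns-sound f i l∈)))) (leafCount-ins r (proj₁ (proj₂ (upIns-sound f j r∈))))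
    disjoint : ∀ {t} → t ∈ singleLeaf n × t ∈ concatMap (upInsNodes f) (splits n) → ⊥
    disjoint (t∈₁ , t∈₂) with singleLeaf-sound n t∈₁ | ∈-concatMap⁻′ _ (splits n) t∈₂
    ... | refl , _ | (i , j) , _ , t∈ₚ with ∈-cartesianProductWith⁻ outParentNode (upIns f i) (upIns f j) t∈ₚ
    ...   | _ , _ , _ , _ , ()

  upIns-complete : ∀ f {t} (h : Tight up t) → sources h ≡ 0 → measure h ≤ f → t ∈ upIns f (leafCount t)
  upIns-complete zero    h           _ le = ⊥-elim (no-fuel h le)
  upIns-complete (suc f) exterior    _ _  = ∈-upIns-leaf f
  upIns-complete (suc f) (out-parent {l} {r} h₁ h₂) no-source le
    with m+n≡0⇒m≡0 (sources h₁) no-source | m+n≡0⇒n≡0 (sources h₁) no-source | measure-children h₁ h₂ le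
  ... | s₁≡0 | s₂≡0 | le₁ , le₂ =
    ∈-upIns-node {f} {leafCount l} {leafCount r} (upIns-complete f h₁ s₁≡0 le₁) (upIns-complete f h₂ s₂≡0 le₂) (sym (length-leafLabels-binary up l up r))

  originCount : ℕ → ℕ → ℕ
  originCount zero zero = 1
  originCount _    _    = 0

  -- the length of Spine.trees lnode rnode base f a b when base has a single element
  spineCount : ℕ → ℕ → ℕ → ℕ
  spineCount zero    a b = 0
  spineCount (suc f) a b = originCount a b + (ℕΣ.Σ-split b (λ b₁ j → spineCount f a b₁ * length (upIns f j))
                                             + ℕΣ.Σ-split a (λ j a₁ → length (upIns f j) * spineCount f a₁ b))

  -- Trees grown from the base trees by repeatedly attaching an all-In up-tree on the right (through lnode)
  -- or on the left (through rnode); a and b count the In leaves so attached on either side.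
  module Spine (lnode rnode : Tree → Tree → Tree) (base : List Tree) where

    atOrigin : ℕ → ℕ → List Tree
    atOrigin zero zero = base
    atOrigin _    _    = []

    mutual
      trees : ℕ → ℕ → ℕ → List Tree
      trees zero    a b = []
      trees (suc f) a b = atOrigin a b ++ (grownLeft f a b ++ grownRight f a b)

      grownLeft : ℕ → ℕ → ℕ → List Tree
      grownLeft f a b = concatMap (λ (b₁ , j) → cartesianProductWith lnode (trees f a b₁) (upIns f j)) (splits b)

      grownRight : ℕ → ℕ → ℕ → List Tree
      grownRight f a b = concatMap (λ (j , a₁) → cartesianProductWith rnode (upIns f j) (trees f a₁ b)) (splits a)

    ∈-trees-origin : ∀ {f t} → t ∈ base → t ∈ trees (suc f) 0 0
    ∈-trees-origin t∈ = ∈-++⁺ˡ t∈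

    ∈-trees-left : ∀ {f a b₁ j b s r} → s ∈ trees f a b₁ → r ∈ upIns f j → b₁ + j ≡ b → lnode s r ∈ trees (suc f) a b
    ∈-trees-left {a = a} {b = b} s∈ r∈ e =
      ∈-++⁺ʳ (atOrigin a b) (∈-++⁺ˡ (∈-concatMap⁺′ _ (∈-splits e) (∈-cartesianProductWith⁺ lnode s∈ r∈)))

    ∈-trees-right : ∀ {f j a₁ a b l s} → l ∈ upIns f j → s ∈ trees f a₁ b → j + a₁ ≡ a → rnode l s ∈ trees (suc f) a b
    ∈-trees-right {f} {a = a} {b} l∈ s∈ e =
      ∈-++⁺ʳ (atOrigin a b) (∈-++⁺ʳ (grownLeft f a b) (∈-concatMap⁺′ _ (∈-splits e) (∈-cartesianProductWith⁺ rnode l∈ s∈)))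

    data AtOrigin : ℕ → ℕ → Tree → Set where
      at-origin : ∀ {t} → t ∈ base → AtOrigin 0 0 t

    data GrownLeft (f a b : ℕ) (t : Tree) : Set where
      grown-left : ∀ {b₁ j s r} → s ∈ trees f a b₁ → r ∈ upIns f j → b₁ + j ≡ b → t ≡ lnode s r → GrownLeft f a b t

    data GrownRight (f a b : ℕ) (t : Tree) : Set where
      grown-right : ∀ {j a₁ l s} → l ∈ upIns f j → s ∈ trees f a₁ b → j + a₁ ≡ a → t ≡ rnode l s → GrownRight f a b t

    ∈-atOrigin⁻ : ∀ a b {t} → t ∈ atOrigin a b → AtOrigin a b t
    ∈-atOrigin⁻ zero zero t∈ = at-origin t∈

    ∈-grownLeft⁻ : ∀ f a b {t} → t ∈ grownLeft f a b → GrownLeft f a b t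
    ∈-grownLeft⁻ f a b t∈ with ∈-concatMap⁻′ _ (splits b) t∈
    ... | (b₁ , j) , p∈ , t∈ₚ with ∈-cartesianProductWith⁻ lnode (trees f a b₁) (upIns f j) t∈ₚ
    ...   | s , r , s∈ , r∈ , refl = grown-left s∈ r∈ (∈-splits⁻ b p∈) refl

    ∈-grownRight⁻ : ∀ f a b {t} → t ∈ grownRight f a b → GrownRight f a b t
    ∈-grownRight⁻ f a b t∈ with ∈-concatMap⁻′ _ (splits a) t∈
    ... | (j , a₁) , p∈ , t∈ₚ with ∈-cartesianProductWith⁻ rnode (upIns f j) (trees f a₁ b) t∈ₚ
    ...   | l , s , l∈ , s∈ , refl = grown-right l∈ s∈ (∈-splits⁻ a p∈) refl

    module _ (P : ℕ → ℕ → Tree → Set)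
             (P-base  : ∀ {t} → t ∈ base → P 0 0 t)
             (P-left  : ∀ {a b₁ j s r} → P a b₁ s → AllIns j r → P a (b₁ + j) (lnode s r))
             (P-right : ∀ {j a₁ b l s} → AllIns j l → P a₁ b s → P (j + a₁) b (rnode l s)) where

      trees-sound : ∀ f a b {t} → t ∈ trees f a b → P a b t
      trees-sound (suc f) a b t∈ with ∈-++⁻ (atOrigin a b) t∈
      ... | inj₁ t∈₀ with ∈-atOrigin⁻ a b t∈₀
      ...   | at-origin t∈b = P-base t∈b
      trees-sound (suc f) a b t∈ | inj₂ t∈₁ with ∈-++⁻ (grownLeft f a b) t∈₁
      ... | inj₁ t∈ₗ with ∈-grownLeft⁻ f a b t∈ₗ
      ...   | grown-left s∈ r∈ refl refl = P-left (trees-sound f a _ s∈) (upIns-sound f _ r∈)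
      trees-sound (suc f) a b t∈ | inj₂ t∈₁ | inj₂ t∈ᵣ with ∈-grownRight⁻ f a b t∈ᵣ
      ...   | grown-right l∈ s∈ refl refl = P-right (upIns-sound f _ l∈) (trees-sound f _ b s∈)

      module _ (base-unique     : Unique base)
               (lnode-injective : ∀ {s s′ r r′} → lnode s r ≡ lnode s′ r′ → s ≡ s′ × r ≡ r′)
               (rnode-injective : ∀ {l l′ s s′} → rnode l s ≡ rnode l′ s′ → l ≡ l′ × s ≡ s′)
               (decodeLeft      : Tree → ℕ × ℕ)
               (decodeLeft-lnode : ∀ {a b₁ j s r} → P a b₁ s → AllIns j r → decodeLeft (lnode s r) ≡ (b₁ , j))
               (decodeRight     : Tree → ℕ × ℕ)
               (decodeRight-rnode : ∀ {j a₁ b l s} → AllIns j l → P a₁ b s → decodeRight (rnode l s) ≡ (j , a₁))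
               (base≢lnode      : ∀ {t s r} → t ∈ base → t ≢ lnode s r)
               (base≢rnode      : ∀ {t l s} → t ∈ base → t ≢ rnode l s)
               (lnode≢rnode     : ∀ {a b₁ j s r j′ a₁ b l s′} → P a b₁ s → AllIns j r → AllIns j′ l → P a₁ b s′ →
                                  lnode s r ≢ rnode l s′) where

        trees-unique : ∀ f a b → Unique (trees f a b)
        trees-unique zero    a b = []
        trees-unique (suc f) a b = ++⁺ (atOrigin-unique a b) (++⁺ left-unique right-unique left-right-disjoint) origin-disjoint
          where
          atOrigin-unique : ∀ a b → Unique (atOrigin a b)
          atOrigin-unique zero    zero    = base-unique
          atOrigin-unique zero    (suc _) = []
          atOrigin-unique (suc _) _       = []
          left-unique : Unique (grownLeft f a b)
          left-unique = unique-concatMap _ decodeLeft (unique-splits b)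
            (λ _ → cartesianProductWith⁺ lnode lnode-injective (trees-unique f a _) (upIns-unique f _)) decode
            where
            decode : ∀ {p t} → p ∈ splits b → t ∈ cartesianProductWith lnode (trees f a (proj₁ p)) (upIns f (proj₂ p)) →
                     decodeLeft t ≡ p
            decode {b₁ , j} _ t∈ with ∈-cartesianProductWith⁻ lnode (trees f a b₁) (upIns f j) t∈
            ... | s , r , s∈ , r∈ , refl = decodeLeft-lnode (trees-sound f a b₁ s∈) (upIns-sound f j r∈)
          right-unique : Unique (grownRight f a b)
          right-unique = unique-concatMap _ decodeRight (unique-splits a)
            (λ _ → cartesianProductWith⁺ rnode rnode-injective (upIns-unique f _) (trees-unique f _ b)) decode
            where
            decode : ∀ {p t} → p ∈ splits a → t ∈ cartesianProductWith rnode (upIns f (proj₁ p)) (trees f (proj₂ p) b) →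
                     decodeRight t ≡ p
            decode {j , a₁} _ t∈ with ∈-cartesianProductWith⁻ rnode (upIns f j) (trees f a₁ b) t∈
            ... | l , s , l∈ , s∈ , refl = decodeRight-rnode (upIns-sound f j l∈) (trees-sound f a₁ b s∈)
          left-right-disjoint : ∀ {t} → t ∈ grownLeft f a b × t ∈ grownRight f a b → ⊥
          left-right-disjoint (t∈ₗ , t∈ᵣ) with ∈-grownLeft⁻ f a b t∈ₗ | ∈-grownRight⁻ f a b t∈ᵣ
          ... | grown-left s∈ r∈ _ t≡ₗ | grown-right l∈ s′∈ _ t≡ᵣ =
            lnode≢rnode (trees-sound f a _ s∈) (upIns-sound f _ r∈) (upIns-sound f _ l∈) (trees-sound f _ b s′∈) (trans (sym t≡ₗ) t≡ᵣ)
          origin-disjoint : ∀ {t} → t ∈ atOrigin a b × t ∈ grownLeft f a b ++ grownRight f a b → ⊥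
          origin-disjoint (t∈₀ , t∈₁) with ∈-atOrigin⁻ a b t∈₀ | ∈-++⁻ (grownLeft f a b) t∈₁
          ... | at-origin t∈b | inj₁ t∈ₗ with ∈-grownLeft⁻ f a b t∈ₗ
          ...   | grown-left _ _ _ t≡ₗ = base≢lnode t∈b t≡ₗ
          origin-disjoint (t∈₀ , t∈₁) | at-origin t∈b | inj₂ t∈ᵣ with ∈-grownRight⁻ f a b t∈ᵣ
          ...   | grown-right _ _ _ t≡ᵣ = base≢rnode t∈b t≡ᵣ

    length-trees : ∀ f a b → length (trees f a b) ≡ spineCount f a b * length base
    length-trees zero    a b = refl
    length-trees (suc f) a b = begin
      length (atOrigin a b ++ (grownLeft f a b ++ grownRight f a b))
        ≡⟨ length-++ (atOrigin a b) ⟩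
      length (atOrigin a b) + length (grownLeft f a b ++ grownRight f a b)
        ≡⟨ cong₂ _+_ (length-atOrigin a b) (length-++ (grownLeft f a b)) ⟩
      originCount a b * L + (length (grownLeft f a b) + length (grownRight f a b))
        ≡⟨ cong (originCount a b * L +_) (cong₂ _+_ length-left length-right) ⟩
      originCount a b * L + (Sₗ * L + Sᵣ * L)
        ≡⟨ distrib (originCount a b) Sₗ Sᵣ L ⟩
      (originCount a b + (Sₗ + Sᵣ)) * L ∎
      where
      open ≡-Reasoning
      L = length base
      Sₗ = ℕΣ.Σ-split b (λ b₁ j → spineCount f a b₁ * length (upIns f j))
      Sᵣ = ℕΣ.Σ-split a (λ j a₁ → length (upIns f j) * spineCount f a₁ b)
      length-atOrigin : ∀ a b → length (atOrigin a b) ≡ originCount a b * L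
      length-atOrigin zero    zero    = sym (+-identityʳ L)
      length-atOrigin zero    (suc _) = refl
      length-atOrigin (suc _) _       = refl
      length-left : length (grownLeft f a b) ≡ Sₗ * L
      length-left = trans (length-concatMap-splits b _) (trans (ℕΣ.Σ-split-cong b (λ b₁ j _ →
        trans (length-cartesianProductWith lnode (trees f a b₁) (upIns f j))
              (trans (cong (_* length (upIns f j)) (length-trees f a b₁)) (swap (spineCount f a b₁) L (length (upIns f j))))))
        (ℕΣ.Σ-split-*ʳ b L _))
        where
        swap : ∀ x y z → x * y * z ≡ x * z * y
        swap = Data.Nat.Tactic.RingSolver.solve-∀
      length-right : length (grownRight f a b) ≡ Sᵣ * L
      length-right = trans (length-concatMap-splits a _) (trans (ℕΣ.Σ-split-cong a (λ j a₁ _ →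
        trans (length-cartesianProductWith rnode (upIns f j) (trees f a₁ b))
              (trans (cong (length (upIns f j) *_) (length-trees f a₁ b)) (sym (*-assoc (length (upIns f j)) (spineCount f a₁ b) L)))))
        (ℕΣ.Σ-split-*ʳ a L _))
      distrib : ∀ o x y l → o * l + (x * l + y * l) ≡ (o + (x + y)) * l
      distrib = Data.Nat.Tactic.RingSolver.solve-∀

  ∈-upIns : ∀ f {t} (h : Tight up t) → sources h ≡ 0 → measure h ≤ f → ∀ {n} → labelsBelow up t ≡ ins n → t ∈ upIns f n
  ∈-upIns f {t} h no-source le e = subst (λ n → t ∈ upIns f n) (leafCount-ins t e) (upIns-complete f h no-source le)

  sources≡0⇒noOut : ∀ {t} (h : Tight up t) → sources h ≡ 0 → outCount (labelsBelow up t) ≡ 0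
  sources≡0⇒noOut h no-source = trans (outCount-labelsBelow h) (trans (+-identityʳ _) no-source)

  DownOneOut : ℕ → ℕ → Tree → Set
  DownOneOut a b t = Tight down t × labelsBelow down t ≡ oneOut a b × containsSource t ≡ false

  module Down = Spine outLeftNode outRightNode (leaf ∷ [])

  -- the tight down-trees labelled In^a Out In^b
  downTrees : ℕ → ℕ → ℕ → List Tree
  downTrees = Down.trees

  private
    down-base : ∀ {t} → t ∈ leaf ∷ [] → DownOneOut 0 0 t
    down-base (here refl) = exterior , refl , refl

    down-left : ∀ {a b₁ j s r} → DownOneOut a b₁ s → AllIns j r → DownOneOut a (b₁ + j) (outLeftNode s r)
    down-left {a} {b₁} {j} {s} {r} (hs , es , ss) (hr , er , sr) =
      out-left hs hr , trans (leafLabels-binary down s up r) (trans (cong₂ _++_ es er) (oneOut-++-ins a b₁ j)) , cong₂ _∨_ ss sr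

    down-right : ∀ {j a₁ b l s} → AllIns j l → DownOneOut a₁ b s → DownOneOut (j + a₁) b (outRightNode l s)
    down-right {j} {a₁} {b} {l} {s} (hl , el , sl) (hs , es , ss) =
      out-right hl hs , trans (leafLabels-binary up l down s) (trans (cong₂ _++_ el es) (ins-++-oneOut j a₁ b)) , cong₂ _∨_ sl ss

  downTrees-sound : ∀ f a b {t} → t ∈ downTrees f a b → DownOneOut a b t
  downTrees-sound = Down.trees-sound DownOneOut down-base down-left down-right

  downTrees-unique : ∀ f a b → Unique (downTrees f a b)
  downTrees-unique = Down.trees-unique DownOneOut down-base down-left down-right
    ([] ∷ []) (λ { refl → refl , refl }) (λ { refl → refl , refl })
    (λ t → afterOut (labelsBelow down (firstChild t)) , leafCount (secondChild t))
    (λ {a} {b₁} {j} {s} {r} (_ , es , _) (_ , er , _) → cong₂ _,_ (trans (cong afterOut es) (afterOut-oneOut a b₁)) (leafCount-ins r er))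
    (λ t → leafCount (firstChild t) , beforeOut (labelsBelow down (secondChild t)))
    (λ {j} {a₁} {b} {l} (_ , el , _) (_ , es , _) → cong₂ _,_ (leafCount-ins l el) (trans (cong beforeOut es) (beforeOut-oneOut a₁ b)))
    (λ { (here refl) () }) (λ { (here refl) () }) (λ _ _ _ _ ())

  downTrees-complete : ∀ f {t} (h : Tight down t) → sources h ≡ 0 → measure h ≤ f →
                       ∀ {a b} → labelsBelow down t ≡ oneOut a b → t ∈ downTrees f a b
  downTrees-complete zero    h        _ le _ = ⊥-elim (no-fuel h le)
  downTrees-complete (suc f) exterior _ _  e with oneOut-injective {0} {0} e
  ... | refl , refl = Down.∈-trees-origin {f} (here refl)
  downTrees-complete (suc f) (out-left {l} {r} h₁ h₂) no-source le e
    with m+n≡0⇒m≡0 (sources h₁) no-source | m+n≡0⇒n≡0 (sources h₁) no-source | measure-children h₁ h₂ le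
  ... | s₁≡0 | s₂≡0 | le₁ , le₂
    with split-oneOut-left (labelsBelow down l) (labelsBelow up r) (trans (sym (leafLabels-binary down l up r)) e) (sources≡0⇒noOut h₂ s₂≡0)
  ...   | b₁ , j , el , er , b₁+j≡b =
    Down.∈-trees-left {f} {b₁ = b₁} {j} (downTrees-complete f h₁ s₁≡0 le₁ el) (∈-upIns f h₂ s₂≡0 le₂ er) b₁+j≡b
  downTrees-complete (suc f) (out-right {l} {r} h₁ h₂) no-source le e
    with m+n≡0⇒m≡0 (sources h₁) no-source | m+n≡0⇒n≡0 (sources h₁) no-source | measure-children h₁ h₂ le
  ... | s₁≡0 | s₂≡0 | le₁ , le₂
    with split-oneOut-right (labelsBelow up l) (labelsBelow down r) (trans (sym (leafLabels-binary up l down r)) e) (sources≡0⇒noOut h₁ s₁≡0)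
  ...   | j , a₁ , el , er , j+a₁≡a =
    Down.∈-trees-right {f} {j} {a₁} (∈-upIns f h₁ s₁≡0 le₁ el) (downTrees-complete f h₂ s₂≡0 le₂ er) j+a₁≡a

  Grafted : ℕ → ℕ → ℕ → ℕ → Tree → Set
  Grafted a₂ b₂ a b t = Tight up t × labelsBelow up t ≡ oneOut (a + a₂) (b + b₂) ×
                        containsSource t ≡ true × spineLeft t ≡ a × spineRight t ≡ b

  -- the tight up-trees with one source, whose path from the root to the source has a In-leaves
  -- hanging on its left and b on its right, and with a tree of L below the source
  graftedTrees : ℕ → ℕ → ℕ → List Tree → List Tree
  graftedTrees f a b L = Spine.trees outParentNode outParentNode (map sourceNode L) f a b

  module _ {L : List Tree} where
    private
      module G = Spine outParentNode outParentNode (map sourceNode L)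

    ∈-graftedTrees-origin : ∀ {f s} → s ∈ L → sourceNode s ∈ graftedTrees (suc f) 0 0 L
    ∈-graftedTrees-origin {f} s∈ = G.∈-trees-origin {f} (∈-map⁺ sourceNode s∈)

    ∈-graftedTrees-left : ∀ {f a b₁ j b s r} → s ∈ graftedTrees f a b₁ L → r ∈ upIns f j → b₁ + j ≡ b →
                          outParentNode s r ∈ graftedTrees (suc f) a b L
    ∈-graftedTrees-left {f} {a} {b₁} {j} = G.∈-trees-left {f} {a} {b₁} {j}

    ∈-graftedTrees-right : ∀ {f j a₁ a b l s} → l ∈ upIns f j → s ∈ graftedTrees f a₁ b L → j + a₁ ≡ a →
                           outParentNode l s ∈ graftedTrees (suc f) a b L
    ∈-graftedTrees-right {f} {j} {a₁} = G.∈-trees-right {f} {j} {a₁}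

  module _ {a₂ b₂ : ℕ} {L : List Tree} (L-sound : ∀ {s} → s ∈ L → DownOneOut a₂ b₂ s) where

    private
      module G = Spine outParentNode outParentNode (map sourceNode L)

      grafted-base : ∀ {t} → t ∈ map sourceNode L → Grafted a₂ b₂ 0 0 t
      grafted-base t∈ with ∈-map⁻ sourceNode t∈
      ... | s , s∈ , refl with L-sound s∈
      ...   | hs , es , _ = source hs , trans (leafLabels-unary down s) es , refl , refl , refl

      grafted-left : ∀ {a b₁ j s r} → Grafted a₂ b₂ a b₁ s → AllIns j r → Grafted a₂ b₂ a (b₁ + j) (outParentNode s r)
      grafted-left {a} {b₁} {j} {s} {r} (hs , es , ss , ls , rs) (hr , er , _) =
        out-parent hs hr ,
        trans (leafLabels-binary up s up r) (trans (cong₂ _++_ es er) (trans (oneOut-++-ins (a + a₂) (b₁ + b₂) j) (cong (oneOut (a + a₂)) (shuffle b₁ b₂ j)))) ,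
        cong (_∨ containsSource r) ss ,
        trans (cong (λ c → if c then spineLeft s else leafCount s + spineLeft r) ss) ls ,
        trans (cong (λ c → if c then spineRight s + leafCount r else spineRight r) ss) (cong₂ _+_ rs (leafCount-ins r er))
        where
        shuffle : ∀ x y z → x + y + z ≡ x + z + y
        shuffle = Data.Nat.Tactic.RingSolver.solve-∀

      grafted-right : ∀ {j a₁ b l s} → AllIns j l → Grafted a₂ b₂ a₁ b s → Grafted a₂ b₂ (j + a₁) b (outParentNode l s)
      grafted-right {j} {a₁} {b} {l} {s} (hl , el , sl) (hs , es , ss , ls , rs) =
        out-parent hl hs ,
        trans (leafLabels-binary up l up s) (trans (cong₂ _++_ el es) (trans (ins-++-oneOut j (a₁ + a₂) (b + b₂)) (cong (λ k → oneOut k (b + b₂)) (sym (+-assoc j a₁ a₂))))) ,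
        trans (cong (_∨ containsSource s) sl) ss ,
        trans (cong (λ c → if c then spineLeft l else leafCount l + spineLeft s) sl) (cong₂ _+_ (leafCount-ins l el) ls) ,
        trans (cong (λ c → if c then spineRight l + leafCount s else spineRight s) sl) rs

    graftedTrees-sound : ∀ f a b {t} → t ∈ graftedTrees f a b L → Grafted a₂ b₂ a b t
    graftedTrees-sound = G.trees-sound (Grafted a₂ b₂) grafted-base grafted-left grafted-right

    graftedTrees-unique : Unique L → ∀ f a b → Unique (graftedTrees f a b L)
    graftedTrees-unique L-unique = G.trees-unique (Grafted a₂ b₂) grafted-base grafted-left grafted-right
      (map⁺ (λ { refl → refl }) L-unique) outParentNode-injective outParentNode-injective
      (λ t → spineRight (firstChild t) , leafCount (secondChild t))
      (λ {_} {_} {j} {_} {r} (_ , _ , _ , _ , rs) (_ , er , _) → cong₂ _,_ rs (leafCount-ins r er))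
      (λ t → leafCount (firstChild t) , spineLeft (secondChild t))
      (λ {_} {_} {_} {l} (_ , el , _) (_ , _ , _ , ls , _) → cong₂ _,_ (leafCount-ins l el) ls)
      base≢outParentNode base≢outParentNode
      (λ (_ , _ , ss , _) _ (_ , _ , sl) _ e → true≢false (trans (sym ss) (trans (cong containsSource (proj₁ (outParentNode-injective e))) sl)))
      where
      base≢outParentNode : ∀ {t l r} → t ∈ map sourceNode L → t ≢ outParentNode l r
      base≢outParentNode t∈ with ∈-map⁻ sourceNode t∈
      ... | _ , _ , refl = λ ()
      true≢false : true ≢ false
      true≢false ()

  measure-source : ∀ {s} (h : Tight down s) → measure (source h) ≡ suc (measure h)
  measure-source {s} h = trans (cong (_+ suc (sources h)) (cong length (leafLabels-unary down s))) (+-suc _ _)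

  sources≡1 : ∀ m n → m + n ≡ 1 → (m ≡ 1 × n ≡ 0) ⊎ (m ≡ 0 × n ≡ 1)
  sources≡1 zero          (suc zero) _ = inj₂ (refl , refl)
  sources≡1 (suc zero)    zero       _ = inj₁ (refl , refl)

  graftedTrees-complete : ∀ f F {t} (h : Tight up t) → sources h ≡ 1 → measure h ≤ f → measure h ≤ F →
    ∀ {a b} → labelsBelow up t ≡ oneOut a b →
    ∃ λ a₁ → ∃ λ a₂ → ∃ λ b₁ → ∃ λ b₂ → a₁ + a₂ ≡ a × b₁ + b₂ ≡ b × t ∈ graftedTrees f a₁ b₁ (downTrees F a₂ b₂)
  graftedTrees-complete zero    F h _ le _ _ = ⊥-elim (no-fuel h le)
  graftedTrees-complete (suc f) F (source {s} h) one-source _ leF {a} {b} e =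
    0 , a , 0 , b , refl , refl ,
    ∈-graftedTrees-origin {f = f} (downTrees-complete F h (suc-injective one-source) (≤-trans (n≤1+n _) (subst (_≤ F) (measure-source h) leF))
                                                    (trans (sym (leafLabels-unary down s)) e))
  graftedTrees-complete (suc f) F (out-parent {l} {r} h₁ h₂) one-source le leF {a} {b} e
    with measure-children h₁ h₂ le | measure-children h₁ h₂ (m≤n⇒m≤1+n leF) | sources≡1 (sources h₁) (sources h₂) one-source
  ... | le₁ , le₂ | leF₁ , leF₂ | inj₁ (s₁≡1 , s₂≡0)
    with split-oneOut-left (labelsBelow up l) (labelsBelow up r) (trans (sym (leafLabels-binary up l up r)) e) (sources≡0⇒noOut h₂ s₂≡0)
  ...   | b′ , j , el , er , b′+j≡b with graftedTrees-complete f F h₁ s₁≡1 le₁ leF₁ el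
  ...     | a₁ , a₂ , b₁ , b₂ , a₁+a₂≡a , b₁+b₂≡b′ , l∈ =
    a₁ , a₂ , b₁ + j , b₂ , a₁+a₂≡a , trans (shuffle b₁ j b₂) (trans (cong (_+ j) b₁+b₂≡b′) b′+j≡b) ,
    ∈-graftedTrees-left {f = f} {b₁ = b₁} {j = j} l∈ (∈-upIns f h₂ s₂≡0 le₂ er) refl
    where
    shuffle : ∀ x y z → x + y + z ≡ x + z + y
    shuffle = Data.Nat.Tactic.RingSolver.solve-∀
  graftedTrees-complete (suc f) F (out-parent {l} {r} h₁ h₂) one-source le leF {a} {b} e
      | le₁ , le₂ | leF₁ , leF₂ | inj₂ (s₁≡0 , s₂≡1)
    with split-oneOut-right (labelsBelow up l) (labelsBelow up r) (trans (sym (leafLabels-binary up l up r)) e) (sources≡0⇒noOut h₁ s₁≡0)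
  ...   | j , a′ , el , er , j+a′≡a with graftedTrees-complete f F h₂ s₂≡1 le₂ leF₂ er
  ...     | a₁ , a₂ , b₁ , b₂ , a₁+a₂≡a′ , b₁+b₂≡b , r∈ =
    j + a₁ , a₂ , b₁ , b₂ , trans (+-assoc j a₁ a₂) (trans (cong (j +_) a₁+a₂≡a′) j+a′≡a) , b₁+b₂≡b ,
    ∈-graftedTrees-right {f = f} {j = j} {a₁ = a₁} (∈-upIns f h₁ s₁≡0 le₁ el) r∈ refl

  -- the tight up-trees labelled In^a Out In^b
  upOneOut : ℕ → ℕ → ℕ → List Tree
  upOneOut f a b =
    concatMap (λ (b₁ , b₂) → concatMap (λ (a₁ , a₂) → graftedTrees f a₁ b₁ (downTrees f a₂ b₂)) (splits a)) (splits b)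

  upOneOut-sound : ∀ f a b {t} → t ∈ upOneOut f a b → Tight up t × labelsBelow up t ≡ oneOut a b
  upOneOut-sound f a b t∈ with ∈-concatMap⁻′ _ (splits b) t∈
  ... | (b₁ , b₂) , q∈ , t∈₁ with ∈-concatMap⁻′ _ (splits a) t∈₁
  ...   | (a₁ , a₂) , p∈ , t∈₂ with graftedTrees-sound (downTrees-sound f a₂ b₂) f a₁ b₁ t∈₂
  ...     | h , e , _ = h , trans e (cong₂ oneOut (∈-splits⁻ a p∈) (∈-splits⁻ b q∈))

  ∈-splits-decode : ∀ {n i j k} → (i , j) ∈ splits n → k ≡ i → (k , n ∸ k) ≡ (i , j)
  ∈-splits-decode {n} {i} {j} p∈ refl = cong (i ,_) (trans (cong (_∸ i) (sym (∈-splits⁻ n p∈))) (m+n∸m≡n i j))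

  upOneOut-unique : ∀ f a b → Unique (upOneOut f a b)
  upOneOut-unique f a b =
    unique-concatMap _ (λ t → spineRight t , b ∸ spineRight t) (unique-splits b)
      (λ {(b₁ , b₂)} _ → unique-concatMap _ (λ t → spineLeft t , a ∸ spineLeft t) (unique-splits a)
         (λ {(a₁ , a₂)} _ → graftedTrees-unique (downTrees-sound f a₂ b₂) (downTrees-unique f a₂ b₂) f a₁ b₁)
         (λ {(a₁ , a₂)} p∈ t∈ → ∈-splits-decode p∈ (spineLeft≡ (graftedTrees-sound (downTrees-sound f a₂ b₂) f a₁ b₁ t∈))))
      decodeRight
    where
    spineLeft≡ : ∀ {a₂ b₂ a₁ b₁ t} → Grafted a₂ b₂ a₁ b₁ t → spineLeft t ≡ a₁
    spineLeft≡ (_ , _ , _ , ls , _) = ls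
    decodeRight : ∀ {q t} → q ∈ splits b → t ∈ concatMap (λ (a₁ , a₂) → graftedTrees f a₁ (proj₁ q) (downTrees f a₂ (proj₂ q))) (splits a) →
                  (spineRight t , b ∸ spineRight t) ≡ q
    decodeRight {b₁ , b₂} q∈ t∈ with ∈-concatMap⁻′ _ (splits a) t∈
    ... | (a₁ , a₂) , _ , t∈₁ with graftedTrees-sound (downTrees-sound f a₂ b₂) f a₁ b₁ t∈₁
    ...   | _ , _ , _ , _ , rs = ∈-splits-decode q∈ rs

  upOneOut-complete : ∀ F {t} (h : Tight up t) → sources h ≡ 1 → measure h ≤ F →
                      ∀ {a b} → labelsBelow up t ≡ oneOut a b → t ∈ upOneOut F a b
  upOneOut-complete F h one-source le e with graftedTrees-complete F F h one-source le le e
  ... | a₁ , a₂ , b₁ , b₂ , a₁+a₂≡a , b₁+b₂≡b , t∈ =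
    ∈-concatMap⁺′ _ (∈-splits b₁+b₂≡b) (∈-concatMap⁺′ _ (∈-splits a₁+a₂≡a) t∈)

module Counting where

  open import Defs
  open CatalanConvolution using (convolution; convolution-diagonal; convolution-corner; pairConvolution)
  open Splits
  open Enumeration
  open import Data.Nat
  open import Data.Nat.Properties
  open import Data.List using (_++_; map; length; concatMap; cartesianProductWith)
  open import Data.List.Properties using (length-++; length-map)
  open import Data.Product using (_×_; _,_)
  open import Relation.Binary.PropositionalEquality
  open ≡-Reasoning

  -- the paper's c_p = C_{p − 1}: the number of binary trees with p leaves
  shiftedCatalan : ℕ → ℕ
  shiftedCatalan zero    = 0
  shiftedCatalan (suc n) = catalan n

  shiftedCatalan-rec : ∀ n → length (singleLeaf n) + ℕΣ.Σ-split n (λ i j → shiftedCatalan i * shiftedCatalan j) ≡ shiftedCatalan n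
  shiftedCatalan-rec zero          = refl
  shiftedCatalan-rec (suc zero)    = refl
  shiftedCatalan-rec (suc (suc n)) = begin
    ℕΣ.Σ-split (suc n) (λ i j → catalan i * shiftedCatalan j)
      ≡⟨ ℕΣ.Σ-split-last n (λ i j → catalan i * shiftedCatalan j) ⟩
    ℕΣ.Σ-split n (λ i j → catalan i * catalan j) + catalan (suc n) * 0
      ≡⟨ cong₂ _+_ (ℕΣ.Σ-split-cong n (λ i j _ → cong₂ (λ x y → catalan x * catalan y) (sym (+-identityʳ i)) (sym (+-identityʳ j))))
                   (*-zeroʳ (catalan (suc n))) ⟩
    convolution n 0 0 + 0
      ≡⟨ +-identityʳ _ ⟩
    convolution n 0 0
      ≡⟨ convolution-diagonal n ⟩
    catalan (suc n) ∎

  length-upIns-0 : ∀ f → length (upIns f 0) ≡ 0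
  length-upIns-0 zero    = refl
  length-upIns-0 (suc f) = begin
    length (concatMap (upInsNodes f) (splits 0))                  ≡⟨ length-concatMap-splits 0 (upInsNodes f) ⟩
    length (cartesianProductWith outParentNode (upIns f 0) (upIns f 0))
                                                                    ≡⟨ length-cartesianProductWith outParentNode (upIns f 0) (upIns f 0) ⟩
    length (upIns f 0) * length (upIns f 0)                         ≡⟨ cong (_* length (upIns f 0)) (length-upIns-0 f) ⟩
    0                                                               ∎

  positive-summands-≤ : ∀ {i j m} → suc i + suc j ≤ suc m → suc i ≤ m × suc j ≤ m
  positive-summands-≤ {i} {j} {m} (s≤s le) =
    ≤-trans (s≤s (m≤m+n i j)) (subst (_≤ m) (+-suc i j) le) , ≤-trans (s≤s (m≤n+m j i)) (subst (_≤ m) (+-suc i j) le)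

  length-upIns : ∀ f n → n ≤ f → length (upIns f n) ≡ shiftedCatalan n
  length-upIns zero    zero    _  = refl
  length-upIns (suc f) n       le = begin
    length (singleLeaf n ++ concatMap (upInsNodes f) (splits n))
      ≡⟨ length-++ (singleLeaf n) ⟩
    length (singleLeaf n) + length (concatMap (upInsNodes f) (splits n))
      ≡⟨ cong (length (singleLeaf n) +_) (length-concatMap-splits n (upInsNodes f)) ⟩
    length (singleLeaf n) + ℕΣ.Σ-split n (λ i j → length (cartesianProductWith outParentNode (upIns f i) (upIns f j)))
      ≡⟨ cong (length (singleLeaf n) +_) (ℕΣ.Σ-split-cong n term) ⟩
    length (singleLeaf n) + ℕΣ.Σ-split n (λ i j → shiftedCatalan i * shiftedCatalan j)
      ≡⟨ shiftedCatalan-rec n ⟩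
    shiftedCatalan n ∎
    where
    term : ∀ i j → i + j ≡ n →
           length (cartesianProductWith outParentNode (upIns f i) (upIns f j)) ≡ shiftedCatalan i * shiftedCatalan j
    term i j i+j≡n = trans (length-cartesianProductWith outParentNode (upIns f i) (upIns f j)) (factors i j i+j≡n)
      where
      factors : ∀ i j → i + j ≡ n → length (upIns f i) * length (upIns f j) ≡ shiftedCatalan i * shiftedCatalan j
      factors zero    j       _ = cong (_* length (upIns f j)) (length-upIns-0 f)
      factors (suc i) zero    _ = trans (cong (length (upIns f (suc i)) *_) (length-upIns-0 f))
                                        (trans (*-zeroʳ (length (upIns f (suc i)))) (sym (*-zeroʳ (catalan i))))
      factors (suc i) (suc j) e with positive-summands-≤ (subst (_≤ suc f) (sym e) le)
      ... | i<f , j<f = cong₂ _*_ (length-upIns f (suc i) i<f) (length-upIns f (suc j) j<f)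

  spineCount-rec : ∀ a b →
    originCount a b + (ℕΣ.Σ-split b (λ b₁ j → catalan (a + b₁) * shiftedCatalan j)
                     + ℕΣ.Σ-split a (λ j a₁ → shiftedCatalan j * catalan (a₁ + b)))
    ≡ catalan (a + b)
  spineCount-rec zero    zero    = refl
  spineCount-rec (suc a) zero    = begin
    catalan (suc a + 0) * 0 + ℕΣ.Σ-split a (λ j a₁ → catalan j * catalan (a₁ + 0))
      ≡⟨ cong₂ _+_ (*-zeroʳ (catalan (suc a + 0)))
                   (ℕΣ.Σ-split-cong a (λ i j _ → cong (λ k → catalan k * catalan (j + 0)) (sym (+-identityʳ i)))) ⟩
    convolution a 0 0                   ≡⟨ convolution-diagonal a ⟩
    catalan (suc a)                     ≡⟨ cong catalan (+-identityʳ (suc a)) ⟨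
    catalan (suc a + 0)                 ∎
  spineCount-rec zero    (suc b) = begin
    ℕΣ.Σ-split (suc b) (λ b₁ j → catalan b₁ * shiftedCatalan j) + 0
      ≡⟨ +-identityʳ _ ⟩
    ℕΣ.Σ-split (suc b) (λ b₁ j → catalan b₁ * shiftedCatalan j)
      ≡⟨ ℕΣ.Σ-split-last b (λ b₁ j → catalan b₁ * shiftedCatalan j) ⟩
    ℕΣ.Σ-split b (λ b₁ j → catalan b₁ * catalan j) + catalan (suc b) * 0
      ≡⟨ cong₂ _+_ (ℕΣ.Σ-split-cong b (λ i j _ → cong₂ (λ x y → catalan x * catalan y) (sym (+-identityʳ i)) (sym (+-identityʳ j))))
                   (*-zeroʳ (catalan (suc b))) ⟩
    convolution b 0 0 + 0               ≡⟨ +-identityʳ _ ⟩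
    convolution b 0 0                   ≡⟨ convolution-diagonal b ⟩
    catalan (suc b)                     ∎
  spineCount-rec (suc a) (suc b) = begin
    ℕΣ.Σ-split (suc b) (λ b₁ j → catalan (suc a + b₁) * shiftedCatalan j) + Sᵣ
      ≡⟨ cong (_+ Sᵣ) (ℕΣ.Σ-split-last b (λ b₁ j → catalan (suc a + b₁) * shiftedCatalan j)) ⟩
    ℕΣ.Σ-split b (λ b₁ j → catalan (suc a + b₁) * catalan j) + catalan (suc a + suc b) * 0 + Sᵣ
      ≡⟨ cong (λ x → x + Sᵣ) (trans (cong₂ _+_ left (*-zeroʳ (catalan (suc a + suc b)))) (+-identityʳ _)) ⟩
    convolution b (suc a) 0 + Sᵣ
      ≡⟨ cong (convolution b (suc a) 0 +_) right ⟩
    convolution b (suc a) 0 + convolution a 0 (suc b)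
      ≡⟨ convolution-corner a b ⟩
    catalan (suc (suc (a + b)))
      ≡⟨ cong (catalan ∘ suc) (+-suc a b) ⟨
    catalan (suc a + suc b) ∎
    where
    open import Function using (_∘_)
    Sᵣ = ℕΣ.Σ-split a (λ j a₁ → catalan j * catalan (a₁ + suc b))
    left : ℕΣ.Σ-split b (λ b₁ j → catalan (suc a + b₁) * catalan j) ≡ convolution b (suc a) 0
    left = ℕΣ.Σ-split-cong b (λ i j _ → cong₂ (λ x y → catalan x * catalan y) (+-comm (suc a) i) (sym (+-identityʳ j)))
    right : Sᵣ ≡ convolution a 0 (suc b)
    right = ℕΣ.Σ-split-cong a (λ i j _ → cong (λ x → catalan x * catalan (j + suc b)) (sym (+-identityʳ i)))

  spineCount-catalan : ∀ f a b → a + b < f → spineCount f a b ≡ catalan (a + b)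
  spineCount-catalan (suc f) a b (s≤s a+b≤f) = begin
    originCount a b + (ℕΣ.Σ-split b (λ b₁ j → spineCount f a b₁ * length (upIns f j))
                     + ℕΣ.Σ-split a (λ j a₁ → length (upIns f j) * spineCount f a₁ b))
      ≡⟨ cong (originCount a b +_) (cong₂ _+_ (ℕΣ.Σ-split-cong b left) (ℕΣ.Σ-split-cong a right)) ⟩
    originCount a b + (ℕΣ.Σ-split b (λ b₁ j → catalan (a + b₁) * shiftedCatalan j)
                     + ℕΣ.Σ-split a (λ j a₁ → shiftedCatalan j * catalan (a₁ + b)))
      ≡⟨ spineCount-rec a b ⟩
    catalan (a + b) ∎
    where
    left : ∀ b₁ j → b₁ + j ≡ b → spineCount f a b₁ * length (upIns f j) ≡ catalan (a + b₁) * shiftedCatalan j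
    left b₁ zero    _ = trans (cong (spineCount f a b₁ *_) (length-upIns-0 f))
                            (trans (*-zeroʳ (spineCount f a b₁)) (sym (*-zeroʳ (catalan (a + b₁)))))
    left b₁ (suc j) e = cong₂ _*_ (spineCount-catalan f a b₁ (≤-trans (+-monoʳ-< a b₁<b) a+b≤f))
                                  (length-upIns f (suc j) (≤-trans (subst (suc j ≤_) e (m≤n+m (suc j) b₁)) (≤-trans (m≤n+m b a) a+b≤f)))
      where
      b₁<b : b₁ < b
      b₁<b = subst (b₁ <_) e (m<m+n b₁ (s≤s z≤n))
    right : ∀ j a₁ → j + a₁ ≡ a → length (upIns f j) * spineCount f a₁ b ≡ shiftedCatalan j * catalan (a₁ + b)
    right zero    a₁ _ = cong (_* spineCount f a₁ b) (length-upIns-0 f)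
    right (suc j) a₁ e = cong₂ _*_ (length-upIns f (suc j) (≤-trans (subst (suc j ≤_) e (m≤m+n (suc j) a₁)) (≤-trans (m≤m+n a b) a+b≤f)))
                                  (spineCount-catalan f a₁ b (≤-trans (+-monoˡ-< b a₁<a) a+b≤f))
      where
      a₁<a : a₁ < a
      a₁<a = subst (a₁ <_) e (m<n+m a₁ (s≤s z≤n))

  length-upOneOut : ∀ f a b → a + b < f → length (upOneOut f a b) ≡ pairConvolution a b
  length-upOneOut f a b a+b<f =
    trans (length-concatMap-splits b _) (ℕΣ.Σ-split-cong b (λ b₁ b₂ b₁+b₂≡b →
      trans (length-concatMap-splits a _) (ℕΣ.Σ-split-cong a (λ a₁ a₂ a₁+a₂≡a →
        grafted a₁ a₂ b₁ b₂ (within (m≤m+n a₁ a₂) (m≤m+n b₁ b₂) a₁+a₂≡a b₁+b₂≡b)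
                            (within (m≤n+m a₂ a₁) (m≤n+m b₂ b₁) a₁+a₂≡a b₁+b₂≡b)))))
    where
    within : ∀ {x y x′ y′} → x ≤ x′ → y ≤ y′ → x′ ≡ a → y′ ≡ b → x + y < f
    within x≤ y≤ refl refl = ≤-trans (s≤s (+-mono-≤ x≤ y≤)) a+b<f
    grafted : ∀ a₁ a₂ b₁ b₂ → a₁ + b₁ < f → a₂ + b₂ < f →
              length (graftedTrees f a₁ b₁ (downTrees f a₂ b₂)) ≡ catalan (a₁ + b₁) * catalan (a₂ + b₂)
    grafted a₁ a₂ b₁ b₂ lt₁ lt₂ = begin
      length (graftedTrees f a₁ b₁ (downTrees f a₂ b₂))
        ≡⟨ Spine.length-trees outParentNode outParentNode (map sourceNode (downTrees f a₂ b₂)) f a₁ b₁ ⟩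
      spineCount f a₁ b₁ * length (map sourceNode (downTrees f a₂ b₂))
        ≡⟨ cong (spineCount f a₁ b₁ *_) (length-map sourceNode (downTrees f a₂ b₂)) ⟩
      spineCount f a₁ b₁ * length (downTrees f a₂ b₂)
        ≡⟨ cong (spineCount f a₁ b₁ *_) (trans (Down.length-trees f a₂ b₂) (*-identityʳ _)) ⟩
      spineCount f a₁ b₁ * spineCount f a₂ b₂
        ≡⟨ cong₂ _*_ (spineCount-catalan f a₁ b₁ lt₁) (spineCount-catalan f a₂ b₂ lt₂) ⟩
      catalan (a₁ + b₁) * catalan (a₂ + b₂) ∎


open import Defs
open import Data.Nat using (ℕ; suc; _+_; _*_; _≤_; _<_)
open import Data.Nat.Combinatorics using (_C_)
open import Data.Product using (Σ; _×_)
open import Relation.Binary.PropositionalEquality using (_≡_)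

open CentralBinomial using (central; catalan*[1+n]≡central)
open CatalanConvolution using (pairConvolution; pairConvolution-central)
open MaximalTrees using (Tight; tight⇒valid; tight⇒maximallyExpanded; maximallyExpanded⇒tight; labelsBelow)
open LabelWords using (oneOut; outCount; outCount-oneOut; length-oneOut)
open Enumeration using (upOneOut; upOneOut-sound; upOneOut-unique; upOneOut-complete; sources; measure; outCount-labelsBelow)
open Counting using (length-upOneOut)
import Data.Nat.Properties as ℕ
import Data.Nat.Tactic.RingSolver as ℕSolver
open import Data.List using (List; []; _∷_; map; length)
open import Data.List.Properties using (length-map)
open import Data.List.Membership.Propositional using (_∈_)
open import Data.List.Membership.Propositional.Properties using (∈-map⁺; ∈-map⁻)
open import Data.List.Relation.Unary.Unique.Propositional.Properties using (map⁺)
open import Data.Product using (_,_)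
open import Data.Empty using (⊥-elim)
open import Function.Bundles using (mk⇔)
open import Relation.Binary.PropositionalEquality using (refl; sym; trans; cong; cong₂)
open Relation.Binary.PropositionalEquality.≡-Reasoning

-- the leaves plus the single source of a maximally expanded α-tree
fuel : ℕ → ℕ → ℕ
fuel ℓ m = ℓ + suc m + 1

rootedUp : Tree → ATree
rootedUp t = up , t

maximallyExpanded-trees : ℕ → ℕ → List ATree
maximallyExpanded-trees ℓ m = map rootedUp (upOneOut (fuel ℓ m) ℓ m)

∈-maximallyExpanded-trees⁻ : ∀ ℓ m {T} → T ∈ maximallyExpanded-trees ℓ m → MaximallyExpanded (alpha ℓ m) T
∈-maximallyExpanded-trees⁻ ℓ m T∈ with ∈-map⁻ rootedUp T∈
... | t , t∈ , refl with upOneOut-sound (fuel ℓ m) ℓ m t∈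
...   | h , e = tight⇒maximallyExpanded (alpha ℓ m) up t (alphaTree t h e) h
  where
  alphaTree : ∀ t → Tight up t → labelsBelow up t ≡ oneOut ℓ m → IsAlphaTree (alpha ℓ m) (up , t)
  alphaTree (node cs) h e = (cs , refl) , tight⇒valid h , cong (Out ∷_) e
  alphaTree leaf      _ e = ⊥-elim (ℕ.0≢1+n (trans (cong outCount e) (outCount-oneOut ℓ m)))

∈-maximallyExpanded-trees⁺ : ∀ ℓ m {T} → MaximallyExpanded (alpha ℓ m) T → T ∈ maximallyExpanded-trees ℓ m
∈-maximallyExpanded-trees⁺ ℓ m {down , t} (((cs , refl) , _ , ()) , _)
∈-maximallyExpanded-trees⁺ ℓ m {up , t} max@(((cs , refl) , _ , e) , _) =
  ∈-map⁺ rootedUp (upOneOut-complete (fuel ℓ m) h one-source measure≤ labels≡)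
  where
  h : Tight up (node cs)
  h = maximallyExpanded⇒tight (alpha ℓ m) up (node cs) max
  labels≡ : labelsBelow up (node cs) ≡ oneOut ℓ m
  labels≡ = cong tail e
    where
    tail : List Label → List Label
    tail []       = []
    tail (_ ∷ xs) = xs
  one-source : sources h ≡ 1
  one-source = trans (sym (ℕ.+-identityʳ (sources h))) (trans (sym (outCount-labelsBelow h)) (trans (cong outCount labels≡) (outCount-oneOut ℓ m)))
  measure≤ : measure h ≤ fuel ℓ m
  measure≤ = ℕ.≤-reflexive (cong₂ _+_ (trans (cong length labels≡) (length-oneOut ℓ m)) one-source)

maximallyExpanded-count : ∀ ℓ m → HasCount (MaximallyExpanded (alpha ℓ m)) (pairConvolution ℓ m)
maximallyExpanded-count ℓ m =
  maximallyExpanded-trees ℓ m ,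
  map⁺ (λ { refl → refl }) (upOneOut-unique (fuel ℓ m) ℓ m) ,
  (λ T → mk⇔ (∈-maximallyExpanded-trees⁻ ℓ m) (∈-maximallyExpanded-trees⁺ ℓ m)) ,
  trans (length-map rootedUp (upOneOut (fuel ℓ m) ℓ m)) (length-upOneOut (fuel ℓ m) ℓ m ℓ+m<fuel)
  where
  ℓ+m<fuel : ℓ + m < fuel ℓ m
  ℓ+m<fuel = ℕ.≤-trans (ℕ.≤-reflexive (sym (ℕ.+-suc ℓ m))) (ℕ.m≤m+n (ℓ + suc m) 1)

pairConvolution-binomial : ∀ ℓ m →
  pairConvolution ℓ m * (2 * (ℓ + m + 1) * (ℓ + m + 2)) ≡ ((2 * (ℓ + 1)) C (ℓ + 1)) * ((2 * (m + 1)) C (m + 1)) * ((ℓ + 1) * (m + 1))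
pairConvolution-binomial ℓ m = begin
  pairConvolution ℓ m * (2 * (ℓ + m + 1) * (ℓ + m + 2))
    ≡⟨ cong₂ (λ x y → pairConvolution ℓ m * (2 * x * y)) (ℕ.+-comm (ℓ + m) 1) (ℕ.+-comm (ℓ + m) 2) ⟩
  pairConvolution ℓ m * (2 * suc (ℓ + m) * suc (suc (ℓ + m)))
    ≡⟨ pairConvolution-central ℓ m ⟩
  central (suc ℓ) * central (suc m) * (suc ℓ * suc m)
    ≡⟨ cong₂ (λ x y → central x * central y * (x * y)) (ℕ.+-comm 1 ℓ) (ℕ.+-comm 1 m) ⟩
  central (ℓ + 1) * central (m + 1) * ((ℓ + 1) * (m + 1)) ∎

pairConvolution-catalan : ∀ ℓ m →
  pairConvolution ℓ m * (2 * (ℓ + m + 1) * (ℓ + m + 2)) ≡ catalan (ℓ + 1) * catalan (m + 1) * ((ℓ + 1) * (ℓ + 2) * (m + 1) * (m + 2))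
pairConvolution-catalan ℓ m = begin
  pairConvolution ℓ m * (2 * (ℓ + m + 1) * (ℓ + m + 2))
    ≡⟨ pairConvolution-binomial ℓ m ⟩
  central (ℓ + 1) * central (m + 1) * ((ℓ + 1) * (m + 1))
    ≡⟨ cong₂ (λ x y → x * y * ((ℓ + 1) * (m + 1))) (central≡ ℓ) (central≡ m) ⟨
  catalan (ℓ + 1) * (ℓ + 2) * (catalan (m + 1) * (m + 2)) * ((ℓ + 1) * (m + 1))
    ≡⟨ regroup (catalan (ℓ + 1)) (catalan (m + 1)) ℓ m ⟩
  catalan (ℓ + 1) * catalan (m + 1) * ((ℓ + 1) * (ℓ + 2) * (m + 1) * (m + 2)) ∎
  where
  central≡ : ∀ n → catalan (n + 1) * (n + 2) ≡ central (n + 1)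
  central≡ n = trans (cong (catalan (n + 1) *_) (ℕ.+-suc n 1)) (catalan*[1+n]≡central (n + 1))
  regroup : ∀ x y l m → x * (l + 2) * (y * (m + 2)) * ((l + 1) * (m + 1)) ≡ x * y * ((l + 1) * (l + 2) * (m + 1) * (m + 2))
  regroup = ℕSolver.solve-∀

proposition4p3 : (ℓ m : ℕ) → Σ ℕ λ c →
    HasCount (MaximallyExpanded (alpha ℓ m)) c
    × (c * (2 * (ℓ + m + 1) * (ℓ + m + 2))
         ≡ catalan (ℓ + 1) * catalan (m + 1) * ((ℓ + 1) * (ℓ + 2) * (m + 1) * (m + 2)))
    × (c * (2 * (ℓ + m + 1) * (ℓ + m + 2))
         ≡ ((2 * (ℓ + 1)) C (ℓ + 1)) * ((2 * (m + 1)) C (m + 1)) * ((ℓ + 1) * (m + 1)))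
proposition4p3 ℓ m =
  pairConvolution ℓ m , maximallyExpanded-count ℓ m , pairConvolution-catalan ℓ m , pairConvolution-binomial ℓ m
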